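{- Let $n\ge 3$, let $\mathcal L$ be a coherent lattice path of size $n+1$ and let $\mathcal L'$ be its restriction (of size $n$). Then $\mathcal L'$ is coherent, and $\mathcal L$ belongs to one of the following 12 mutually exclusive cases, where lists of enhanced steps are ordered lists, "$\mathcal S,\ s_1,\dots,s_t$" means the list $\mathcal S$ followed by the steps $s_1,\dots,s_t$, and $\mathcal S(\cdot)$ denotes the list of enhanced steps: (i) $\mathcal L'$ ends with the step $(x\to n;n-1)$ with $x<n-1$; let $\mathcal S'$ be $\mathcal S(\mathcal L')$ with this last step removed. Then $\mathcal S(\mathcal L)$ is one of: (a) $\mathcal S(\mathcal L'),\ (n-1\to n+1;n)$; (b) $\mathcal S(\mathcal L'),\ (n\to n+1;n-1),\ (n-1\to n;n+1)$; (c) $\mathcal S',\ (x\to n+1;n-1),\ (n-1\to n;n+1)$. (ii) $\mathcal L'$ ends with the steps $(x\to n;y_1),(y_1\to y_2;n),\dots,(y_{m-1}\to y_m;n)$ with $x<n-1$, $m\ge3$, $y_1<\dots<y_m=n-1$; let $\mathcal S'$ be $\mathcal S(\mathcal L')$ with these $m$ final steps removed. Then $\mathcal S(\mathcal L)$ is one of: (a) $\mathcal S(\mathcal L'),\ (n-1\to n+1;n)$; (b) $\mathcal S(\mathcal L')$ with its last step $(y_{m-1}\to n-1;n)$ replaced by $(y_{m-1}\to n+1;n)$; (c) $\mathcal S',\ (x\to n+1;y_1),(y_1\to y_2;n+1),\dots,(y_{m-2}\to y_{m-1};n+1),(y_{m-1}\to n-1;n+1),(n-1\to n;n+1)$; (d)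 $\mathcal S',\ (x\to n+1;y_1),(y_1\to y_2;n+1),\dots,(y_{m-2}\to y_{m-1};n+1),(y_{m-1}\to n;n+1)$. (iii) $\mathcal L'$ ends with the steps $(x\to n;y),(y\to n-1;n)$ with $x<n$, $y<n-1$; let $\mathcal S'$ be $\mathcal S(\mathcal L')$ with these two steps removed. Then $\mathcal S(\mathcal L)$ is one of: (a) $\mathcal S(\mathcal L'),\ (n-1\to n+1;n)$; (b) $\mathcal S(\mathcal L')$ with its last step $(y\to n-1;n)$ replaced by $(y\to n+1;n)$; (c) $\mathcal S(\mathcal L')$ with its last step $(y\to n-1;n)$ removed, followed by $(n\to n+1;y),(y\to n;n+1)$; (d) $\mathcal S',\ (x\to n+1;y),(y\to n-1;n+1),(n-1\to n;n+1)$; (e) $\mathcal S',\ (x\to n+1;y),(y\to n;n+1)$.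
   Context: A diagonal-avoiding lattice path of size $n$ and dimension $2$ is a sequence $(\boldsymbol\ell_1,\dots,\boldsymbol\ell_r)$ of points of $[n]^2$ with $\boldsymbol\ell_1=(2,1)$, $\boldsymbol\ell_r\in\{(n-1,n),(n,n-1)\}$, $\ell_{i,1}\neq\ell_{i,2}$ for all $i$, and for each $i\in[r-1]$ exactly one coordinate $p$ changes, with $\ell_{i,p}<\ell_{i+1,p}$ (the other coordinate $q$ staying fixed). Its $i$-th enhanced step is written $(\ell_{i,p}\to\ell_{i+1,p};\ell_{i,q})$ ("the moving coordinate goes from $\ell_{i,p}$ to $\ell_{i+1,p}$ while the other coordinate equals $\ell_{i,q}$"); steps are ordered by $\prec$ according to their position in the path; the length is $r$. Such a path is a coherent lattice path if for every pair of enhanced steps $(i\to j;a)\prec(x\to y;z)$ with $x<j$ one has $j=z$ or $x=a$. The restriction of a diagonal-avoiding lattice path $\mathcal L=(\boldsymbol\ell_1,\dots,\boldsymbol\ell_r)$ of size $n+1$ (dimension 2) is the diagonal-avoiding lattice path $\mathcal L'$ of size $n$ obtained as follows: (1) replace every coordinate equal to $n+1$ by $n$ in each point, obtaining $\boldsymbol\ell'_1,\dots,\boldsymbol\ell'_r$ (so $\boldsymbol\ell'_r=(n,n)$); (2) if $\boldsymbol\ell'_{r-1}=(x,n)$ set $\boldsymbol\ell'_r=(n-1,n)$, and if $\boldsymbol\ell'_{r-1}=(n,x)$ set $\boldsymbol\ell'_r=(n,n-1)$; (3) whenever two consecutive points coincide, discard the repetition, until no consecutive repeats remain. -}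

module Defs where

open import Data.Nat using (ℕ; zero; suc; _∸_; _≤_; _<_; _≟_)
open import Data.Product using (_×_; _,_; Σ; ∃; ∃-syntax)
open import Data.Sum using (_⊎_)
open import Data.List using (List; []; _∷_; _++_; head; last; length; [_])
open import Data.Maybe using (just)
open import Data.List.Relation.Unary.All using (All)
open import Data.List.Relation.Unary.Linked using (Linked)
open import Data.List.Relation.Unary.AllPairs using (AllPairs)
open import Relation.Binary.PropositionalEquality using (_≡_; _≢_)
open import Relation.Nullary using (yes; no; Dec)
open import Data.Product.Properties using (≡-dec)
import Data.List

-- Points of [n]^2 (coordinates are positive naturals, range checked separately).
Pt : Set
Pt = ℕ × ℕ

-- Enhanced step (src → tgt ; oth): the moving coordinate goes from src to tgt,
-- the other coordinate equals oth.
record EStep : Set where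
  constructor ⟨_⟶_∣_⟩
  field
    src tgt oth : ℕ

step : Pt → Pt → EStep
step (a , b) (c , d) with a ≟ c
... | yes _ = ⟨ b ⟶ d ∣ a ⟩
... | no  _ = ⟨ a ⟶ c ∣ b ⟩

steps : List Pt → List EStep
steps (p ∷ rest@(q ∷ _)) = step p q ∷ steps rest
steps _ = []

Move : Pt → Pt → Set
Move (a , b) (c , d) = (a ≡ c × b < d) ⊎ (b ≡ d × a < c)

OffDiag : ℕ → Pt → Set
OffDiag n (a , b) = (1 ≤ a × a ≤ n) × (1 ≤ b × b ≤ n) × a ≢ b

DALP : ℕ → List Pt → Set
DALP n L =
  head L ≡ just (2 , 1)
  × (last L ≡ just (n ∸ 1 , n) ⊎ last L ≡ just (n , n ∸ 1))
  × All (OffDiag n) L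
  × Linked Move L

CoherentPair : EStep → EStep → Set
CoherentPair ⟨ i ⟶ j ∣ a ⟩ ⟨ x ⟶ y ∣ z ⟩ = x < j → (j ≡ z ⊎ x ≡ a)

Coherent : ℕ → List Pt → Set
Coherent n L = DALP n L × AllPairs CoherentPair (steps L)

clampC : ℕ → ℕ → ℕ
clampC n x with x ≟ suc n
... | yes _ = n
... | no  _ = x

clampP : ℕ → Pt → Pt
clampP n (a , b) = clampC n a , clampC n b

newLast : ℕ → Pt → Pt → Pt
newLast n (x , y) q with y ≟ n
... | yes _ = (n ∸ 1 , n)
... | no  _ with x ≟ n
...   | yes _ = (n , n ∸ 1)
...   | no  _ = q

fixLast : ℕ → List Pt → List Pt
fixLast n (p ∷ q ∷ []) = p ∷ newLast n p q ∷ []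
fixLast n (p ∷ rest@(_ ∷ _ ∷ _)) = p ∷ fixLast n rest
fixLast n L = L

_≟ₚ_ : (u v : Pt) → Dec (u ≡ v)
_≟ₚ_ = ≡-dec _≟_ _≟_

consNR : Pt → List Pt → List Pt
consNR p [] = p ∷ []
consNR p (q ∷ ys) with p ≟ₚ q
... | yes _ = q ∷ ys
... | no  _ = p ∷ q ∷ ys

dedup : List Pt → List Pt
dedup [] = []
dedup (p ∷ xs) = consNR p (dedup xs)

restrict : ℕ → List Pt → List Pt
restrict n L = dedup (fixLast n (Data.List.map (clampP n) L))

chain : ℕ → List ℕ → List EStep
chain c (y ∷ rest@(y' ∷ _)) = ⟨ y ⟶ y' ∣ c ⟩ ∷ chain c rest
chain c _ = []

data CaseLabel : Set where
  i-a i-b i-c : CaseLabel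
  ii-a ii-b ii-c ii-d : CaseLabel
  iii-a iii-b iii-c iii-d iii-e : CaseLabel

Case : ℕ → List EStep → List EStep → CaseLabel → Set
Case n S S' i-a = ∃[ x ] ∃[ Sp ] (x < n ∸ 1 × S' ≡ Sp ++ [ ⟨ x ⟶ n ∣ n ∸ 1 ⟩ ]
  × S ≡ S' ++ [ ⟨ n ∸ 1 ⟶ suc n ∣ n ⟩ ])
Case n S S' i-b = ∃[ x ] ∃[ Sp ] (x < n ∸ 1 × S' ≡ Sp ++ [ ⟨ x ⟶ n ∣ n ∸ 1 ⟩ ]
  × S ≡ S' ++ ⟨ n ⟶ suc n ∣ n ∸ 1 ⟩ ∷ ⟨ n ∸ 1 ⟶ n ∣ suc n ⟩ ∷ [])
Case n S S' i-c = ∃[ x ] ∃[ Sp ] (x < n ∸ 1 × S' ≡ Sp ++ [ ⟨ x ⟶ n ∣ n ∸ 1 ⟩ ]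
  × S ≡ Sp ++ ⟨ x ⟶ suc n ∣ n ∸ 1 ⟩ ∷ ⟨ n ∸ 1 ⟶ n ∣ suc n ⟩ ∷ [])
-- (ii): y₁ < y₂ < … < yₘ = n-1 with m ≥ 3 written as y₁ ∷ mid ++ w ∷ (n-1) ∷ [],
-- w = yₘ₋₁, m = length mid + 3;
-- S' = Sp , (x→n;y₁), (y₁→y₂;n), …, (yₘ₋₂→w;n), (w→n-1;n) with x < n-1
Case n S S' ii-a = ∃[ x ] ∃[ y₁ ] ∃[ mid ] ∃[ w ] ∃[ Sp ]
  (x < n ∸ 1 × Linked _<_ (y₁ ∷ mid ++ w ∷ n ∸ 1 ∷ [])
  × S' ≡ Sp ++ ⟨ x ⟶ n ∣ y₁ ⟩ ∷ chain n (y₁ ∷ mid ++ [ w ]) ++ [ ⟨ w ⟶ n ∸ 1 ∣ n ⟩ ]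
  × S ≡ S' ++ [ ⟨ n ∸ 1 ⟶ suc n ∣ n ⟩ ])
Case n S S' ii-b = ∃[ x ] ∃[ y₁ ] ∃[ mid ] ∃[ w ] ∃[ Sp ]
  (x < n ∸ 1 × Linked _<_ (y₁ ∷ mid ++ w ∷ n ∸ 1 ∷ [])
  × S' ≡ Sp ++ ⟨ x ⟶ n ∣ y₁ ⟩ ∷ chain n (y₁ ∷ mid ++ [ w ]) ++ [ ⟨ w ⟶ n ∸ 1 ∣ n ⟩ ]
  × S ≡ Sp ++ ⟨ x ⟶ n ∣ y₁ ⟩ ∷ chain n (y₁ ∷ mid ++ [ w ]) ++ [ ⟨ w ⟶ suc n ∣ n ⟩ ])
Case n S S' ii-c = ∃[ x ] ∃[ y₁ ] ∃[ mid ] ∃[ w ] ∃[ Sp ]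
  (x < n ∸ 1 × Linked _<_ (y₁ ∷ mid ++ w ∷ n ∸ 1 ∷ [])
  × S' ≡ Sp ++ ⟨ x ⟶ n ∣ y₁ ⟩ ∷ chain n (y₁ ∷ mid ++ [ w ]) ++ [ ⟨ w ⟶ n ∸ 1 ∣ n ⟩ ]
  × S ≡ Sp ++ ⟨ x ⟶ suc n ∣ y₁ ⟩ ∷ chain (suc n) (y₁ ∷ mid ++ [ w ])
          ++ ⟨ w ⟶ n ∸ 1 ∣ suc n ⟩ ∷ ⟨ n ∸ 1 ⟶ n ∣ suc n ⟩ ∷ [])
Case n S S' ii-d = ∃[ x ] ∃[ y₁ ] ∃[ mid ] ∃[ w ] ∃[ Sp ]
  (x < n ∸ 1 × Linked _<_ (y₁ ∷ mid ++ w ∷ n ∸ 1 ∷ [])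
  × S' ≡ Sp ++ ⟨ x ⟶ n ∣ y₁ ⟩ ∷ chain n (y₁ ∷ mid ++ [ w ]) ++ [ ⟨ w ⟶ n ∸ 1 ∣ n ⟩ ]
  × S ≡ Sp ++ ⟨ x ⟶ suc n ∣ y₁ ⟩ ∷ chain (suc n) (y₁ ∷ mid ++ [ w ])
          ++ [ ⟨ w ⟶ n ∣ suc n ⟩ ])
Case n S S' iii-a = ∃[ x ] ∃[ y ] ∃[ Sp ] (x < n × y < n ∸ 1
  × S' ≡ Sp ++ ⟨ x ⟶ n ∣ y ⟩ ∷ ⟨ y ⟶ n ∸ 1 ∣ n ⟩ ∷ []
  × S ≡ S' ++ [ ⟨ n ∸ 1 ⟶ suc n ∣ n ⟩ ])
Case n S S' iii-b = ∃[ x ] ∃[ y ] ∃[ Sp ] (x < n × y < n ∸ 1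
  × S' ≡ Sp ++ ⟨ x ⟶ n ∣ y ⟩ ∷ ⟨ y ⟶ n ∸ 1 ∣ n ⟩ ∷ []
  × S ≡ Sp ++ ⟨ x ⟶ n ∣ y ⟩ ∷ ⟨ y ⟶ suc n ∣ n ⟩ ∷ [])
Case n S S' iii-c = ∃[ x ] ∃[ y ] ∃[ Sp ] (x < n × y < n ∸ 1
  × S' ≡ Sp ++ ⟨ x ⟶ n ∣ y ⟩ ∷ ⟨ y ⟶ n ∸ 1 ∣ n ⟩ ∷ []
  × S ≡ Sp ++ ⟨ x ⟶ n ∣ y ⟩ ∷ ⟨ n ⟶ suc n ∣ y ⟩ ∷ ⟨ y ⟶ n ∣ suc n ⟩ ∷ [])
Case n S S' iii-d = ∃[ x ] ∃[ y ] ∃[ Sp ] (x < n × y < n ∸ 1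
  × S' ≡ Sp ++ ⟨ x ⟶ n ∣ y ⟩ ∷ ⟨ y ⟶ n ∸ 1 ∣ n ⟩ ∷ []
  × S ≡ Sp ++ ⟨ x ⟶ suc n ∣ y ⟩ ∷ ⟨ y ⟶ n ∸ 1 ∣ suc n ⟩ ∷ ⟨ n ∸ 1 ⟶ n ∣ suc n ⟩ ∷ [])
Case n S S' iii-e = ∃[ x ] ∃[ y ] ∃[ Sp ] (x < n × y < n ∸ 1
  × S' ≡ Sp ++ ⟨ x ⟶ n ∣ y ⟩ ∷ ⟨ y ⟶ n ∸ 1 ∣ n ⟩ ∷ []
  × S ≡ Sp ++ ⟨ x ⟶ suc n ∣ y ⟩ ∷ ⟨ y ⟶ n ∣ suc n ⟩ ∷ [])

ExactlyOneCase : ℕ → List Pt → Set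
ExactlyOneCase n L =
  Σ CaseLabel λ c → Case n (steps L) (steps (restrict n L)) c
    × (∀ d → Case n (steps L) (steps (restrict n L)) d → d ≡ c)

-- Cut L at its first point outside [n-1]²: L = P ++ q ∷ W with q = (x , y) up to swapping the
-- coordinates.  Coherence of the step leaving [n-1]² with the later steps leaves W three shapes:
-- up column n to (n , n+1), up column n+1 to (n+1 , n), or (n , y) (n+1 , y) (n+1 , n).  In each
-- of them the restriction is P ++ q followed by a climb of column n through the same heights,
-- capped at n-1, so it inherits coherence from L.  The case is decided by how many heights that
-- climb has (one, two, more: cases i, iii, ii), by the shape of W, and by whether L itself passed
-- through height n-1; and it can be read back from the last two steps of S(L) and of S(L').

module Submission where

open import Defs
open import Data.Bool using (Bool; true; false; if_then_else_)
open import Data.Empty using (⊥; ⊥-elim)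
open import Data.List using (List; []; _∷_; _++_; _∷ʳ_; [_]; head; last; map; initLast; _∷ʳ′_)
open import Data.List.Properties using (++-assoc; map-++; last-map)
open import Data.List.Membership.Propositional using (_∈_)
open import Data.List.Membership.Propositional.Properties using (∈-++⁺ʳ)
open import Data.List.Relation.Unary.All as All using (All; []; _∷_)
import Data.List.Relation.Unary.All.Properties as All
open import Data.List.Relation.Unary.AllPairs using (AllPairs; []; _∷_) renaming (head to allPairs-head)
import Data.List.Relation.Unary.AllPairs.Properties as AllPairs
open import Data.List.Relation.Unary.Any using (here; there)
open import Data.List.Relation.Unary.Linked as Linked using (Linked; []; [-]; _∷_)
open import Data.List.Relation.Unary.Linked.Properties using (Linked⇒All)
open import Data.Maybe as Maybe using (just)
open import Data.Maybe.Properties using (just-injective)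
open import Data.Nat using (ℕ; suc; _∸_; _≤_; _<_; _≟_; _<?_; z≤n; s≤s)
open import Data.Nat.Properties
open import Data.Product using (_×_; _,_; proj₁; proj₂; ∃-syntax)
open import Data.Sum as Sum using (_⊎_; inj₁; inj₂)
open import Function using (_∘_)
open import Relation.Binary.PropositionalEquality hiding ([_])
open import Relation.Nullary using (¬_; Dec; yes; no; does)
open import Relation.Nullary.Decidable using (dec-true; dec-false; _×-dec_)

open EStep

-- pt o a b reads (a , b) in orientation o (o = true swaps the coordinates), so that
-- every argument about a horizontal move followed by vertical ones covers both orders.
pt : Bool → ℕ → ℕ → Pt
pt false a b = a , b
pt true  a b = b , a

pt-injective : ∀ o {a b c d} → pt o a b ≡ pt o c d → a ≡ c × b ≡ d
pt-injective false refl = refl , refl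
pt-injective true  refl = refl , refl

step-vertical : ∀ o a {b d} → b ≢ d → step (pt o a b) (pt o a d) ≡ ⟨ b ⟶ d ∣ a ⟩
step-vertical false a b≢d with a ≟ a
... | yes _ = refl
... | no a≢a = ⊥-elim (a≢a refl)
step-vertical true a {b} {d} b≢d with b ≟ d
... | yes b≡d = ⊥-elim (b≢d b≡d)
... | no _ = refl

step-horizontal : ∀ o {a c} b → a ≢ c → step (pt o a b) (pt o c b) ≡ ⟨ a ⟶ c ∣ b ⟩
step-horizontal false {a} {c} b a≢c with a ≟ c
... | yes a≡c = ⊥-elim (a≢c a≡c)
... | no _ = refl
step-horizontal true b a≢c with b ≟ b
... | yes _ = refl
... | no b≢b = ⊥-elim (b≢b refl)

move-vertical : ∀ o a {b d} → b < d → Move (pt o a b) (pt o a d)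
move-vertical false a b<d = inj₁ (refl , b<d)
move-vertical true  a b<d = inj₂ (refl , b<d)

move-horizontal : ∀ o {a c} b → a < c → Move (pt o a b) (pt o c b)
move-horizontal false b a<c = inj₂ (refl , a<c)
move-horizontal true  b a<c = inj₁ (refl , a<c)

data MoveFrom (o : Bool) (a b : ℕ) : Pt → Set where
  up    : ∀ {d} → b < d → MoveFrom o a b (pt o a d)
  right : ∀ {c} → a < c → MoveFrom o a b (pt o c b)

move-from : ∀ o a b {r} → Move (pt o a b) r → MoveFrom o a b r
move-from false a b (inj₁ (refl , b<d)) = up b<d
move-from false a b (inj₂ (refl , a<c)) = right a<c
move-from true  a b (inj₁ (refl , a<c)) = right a<c
move-from true  a b (inj₂ (refl , b<d)) = up b<d

move-oriented : ∀ {p r} → Move p r → ∃[ o ] ∃[ a ] ∃[ b ] ∃[ c ] (p ≡ pt o a b × r ≡ pt o c b × a < c)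
move-oriented {u , v} (inj₁ (refl , v<d)) = true , v , u , _ , refl , refl , v<d
move-oriented {u , v} (inj₂ (refl , u<c)) = false , u , v , _ , refl , refl , u<c

move⇒≢ : ∀ {p r} → Move p r → p ≢ r
move⇒≢ (inj₁ (refl , b<d)) refl = <-irrefl refl b<d
move⇒≢ (inj₂ (refl , a<c)) refl = <-irrefl refl a<c

offDiag-pt⁻ : ∀ m o a b → OffDiag m (pt o a b) → OffDiag m (a , b)
offDiag-pt⁻ m false a b od = od
offDiag-pt⁻ m true  a b (ib , ia , b≢a) = ia , ib , ≢-sym b≢a

offDiag-pt⁺ : ∀ m o a b → OffDiag m (a , b) → OffDiag m (pt o a b)
offDiag-pt⁺ m false a b od = od
offDiag-pt⁺ m true  a b (ia , ib , a≢b) = ib , ia , ≢-sym a≢b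

Inner : ℕ → Pt → Set
Inner n (a , b) = a < n × b < n

inner-pt⁻ : ∀ n o a b → Inner n (pt o a b) → Inner n (a , b)
inner-pt⁻ n false a b inner       = inner
inner-pt⁻ n true  a b (b<n , a<n) = a<n , b<n

inner-pt⁺ : ∀ {n} o {a b} → Inner n (a , b) → Inner n (pt o a b)
inner-pt⁺ false inner       = inner
inner-pt⁺ true  (a<n , b<n) = b<n , a<n

∸1< : ∀ {n} → 0 < n → n ∸ 1 < n
∸1< {suc n} _ = n<1+n n

<⇒≤∸1 : ∀ {x n} → x < n → x ≤ n ∸ 1
<⇒≤∸1 {n = suc n} (s≤s x≤n) = x≤n

module _ {A : Set} where

  head-++ : ∀ (P : List A) q X → head (P ++ q ∷ X) ≡ head (P ∷ʳ q)
  head-++ []      q X = refl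
  head-++ (p ∷ P) q X = refl

  last-++ : ∀ (P : List A) q X → last (P ++ q ∷ X) ≡ last (q ∷ X)
  last-++ []           q X = refl
  last-++ (p ∷ [])     q X = refl
  last-++ (p ∷ p' ∷ P) q X = last-++ (p' ∷ P) q X

  last-∷ʳ : ∀ (P : List A) e → last (P ∷ʳ e) ≡ just e
  last-∷ʳ P e = last-++ P e []

  last-∷ : ∀ x (xs : List A) → ∃[ e ] last (x ∷ xs) ≡ just e
  last-∷ x []       = x , refl
  last-∷ x (y ∷ xs) = last-∷ y xs

  All-∷ʳ⁻ : ∀ {Q : A → Set} (P : List A) {e} → All Q (P ∷ʳ e) → All Q P × Q e
  All-∷ʳ⁻ P all with All.++⁻ P all
  ... | allP , qe ∷ [] = allP , qe

  module _ {R : A → A → Set} where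

    linked-++⁻ˡ : ∀ xs {ys} → Linked R (xs ++ ys) → Linked R xs
    linked-++⁻ˡ []           _        = []
    linked-++⁻ˡ (x ∷ [])     _        = [-]
    linked-++⁻ˡ (x ∷ y ∷ xs) (r ∷ rs) = r ∷ linked-++⁻ˡ (y ∷ xs) rs

    linked-++⁻ʳ : ∀ xs {ys} → Linked R (xs ++ ys) → Linked R ys
    linked-++⁻ʳ []       rs = rs
    linked-++⁻ʳ (x ∷ xs) rs = linked-++⁻ʳ xs (Linked.tail rs)

    linked-join : ∀ xs q {ys} → Linked R (xs ∷ʳ q) → Linked R (q ∷ ys) → Linked R (xs ++ q ∷ ys)
    linked-join []           q _        rs' = rs'
    linked-join (x ∷ [])     q (r ∷ _)  rs' = r ∷ rs'
    linked-join (x ∷ y ∷ xs) q (r ∷ rs) rs' = r ∷ linked-join (y ∷ xs) q rs rs'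

    linked-∷ʳ₂ : ∀ xs {a b} → Linked R (xs ++ a ∷ b ∷ []) → R a b
    linked-∷ʳ₂ xs rs with linked-++⁻ʳ xs rs
    ... | r ∷ _ = r

    allPairs-++⁻ : ∀ xs {ys} → AllPairs R (xs ++ ys) →
      AllPairs R xs × AllPairs R ys × All (λ x → All (R x) ys) xs
    allPairs-++⁻ []       rs       = [] , rs , []
    allPairs-++⁻ (x ∷ xs) (r ∷ rs) with allPairs-++⁻ xs rs
    ... | rxs , rys , rxsys = All.++⁻ˡ xs r ∷ rxs , rys , All.++⁻ʳ xs r ∷ rxsys

linked-<-last : ∀ xs {b} → Linked _<_ (xs ∷ʳ b) → All (_< b) xs
linked-<-last []           _          = []
linked-<-last (x ∷ [])     (x<b ∷ _)  = x<b ∷ []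
linked-<-last (x ∷ y ∷ xs) (x<y ∷ rs) with linked-<-last (y ∷ xs) rs
... | y<b ∷ rest = <-trans x<y y<b ∷ y<b ∷ rest

linked-<-tail : ∀ {y} xs → Linked _<_ (y ∷ xs) → All (y <_) xs
linked-<-tail []       [-]        = []
linked-<-tail (x ∷ xs) (y<x ∷ rs) = Linked⇒All <-trans y<x rs

linked-≤-last : ∀ {t} xs → Linked _<_ xs → last xs ≡ just t → All (_≤ t) xs
linked-≤-last (x ∷ [])     _          refl  = ≤-refl ∷ []
linked-≤-last (x ∷ y ∷ xs) (x<y ∷ rs) last≡ with linked-≤-last (y ∷ xs) rs last≡
... | y≤t ∷ rest = ≤-trans (<⇒≤ x<y) y≤t ∷ y≤t ∷ rest

linked-<-head : ∀ {y} xs → Linked _<_ (y ∷ xs) → All (y ≤_) (y ∷ xs)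
linked-<-head []       [-]        = ≤-refl ∷ []
linked-<-head (x ∷ xs) (y<x ∷ rs) = ≤-refl ∷ All.map (≤-trans (<⇒≤ y<x)) (linked-<-head xs rs)

∷ʳ-view : ∀ {A : Set} {y t : A} hs → last (y ∷ hs) ≡ just t → y ≢ t → ∃[ zs ] hs ≡ zs ∷ʳ t
∷ʳ-view hs last≡ y≢t with initLast hs
... | [] = ⊥-elim (y≢t (just-injective last≡))
∷ʳ-view {y = y} _ last≡ y≢t | zs ∷ʳ′ e with trans (sym (last-∷ʳ (y ∷ zs) e)) last≡
... | refl = zs , refl

steps-++ : ∀ (P : List Pt) q T → steps (P ++ q ∷ T) ≡ steps (P ∷ʳ q) ++ steps (q ∷ T)
steps-++ []           q T = refl
steps-++ (p ∷ [])     q T = refl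
steps-++ (p ∷ p' ∷ P) q T = cong (step p p' ∷_) (steps-++ (p' ∷ P) q T)

chain-++ : ∀ c (xs : List ℕ) a ys → chain c (xs ++ a ∷ ys) ≡ chain c (xs ∷ʳ a) ++ chain c (a ∷ ys)
chain-++ c []            a ys = refl
chain-++ c (x ∷ [])      a ys = refl
chain-++ c (x ∷ x' ∷ xs) a ys = cong (⟨ x ⟶ x' ∣ c ⟩ ∷_) (chain-++ c (x' ∷ xs) a ys)

chain-∷ʳ : ∀ c zs {a} b → last zs ≡ just a → chain c (zs ∷ʳ b) ≡ chain c zs ∷ʳ ⟨ a ⟶ b ∣ c ⟩
chain-∷ʳ c (z ∷ [])      b refl   = refl
chain-∷ʳ c (z ∷ z' ∷ zs) b last≡ = cong (⟨ z ⟶ z' ∣ c ⟩ ∷_) (chain-∷ʳ c (z' ∷ zs) b last≡)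

moves-column : ∀ o c {hs} → Linked _<_ hs → Linked Move (map (pt o c) hs)
moves-column o c []          = []
moves-column o c [-]         = [-]
moves-column o c (h<h' ∷ rs) = move-vertical o c h<h' ∷ moves-column o c rs

steps-column : ∀ o c {zs} → Linked _<_ zs → steps (map (pt o c) zs) ≡ chain c zs
steps-column o c []          = refl
steps-column o c [-]         = refl
steps-column o c (z<z' ∷ rs) = cong₂ _∷_ (step-vertical o c (<⇒≢ z<z')) (steps-column o c rs)

chain-src-≥ : ∀ c {b} rest → Linked _<_ (b ∷ rest) → All (λ t → b ≤ src t) (chain c (b ∷ rest))
chain-src-≥ c []          _           = []
chain-src-≥ c (b' ∷ rest) (b<b' ∷ rs) = ≤-refl ∷ All.map (≤-trans (<⇒≤ b<b')) (chain-src-≥ c rest rs)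

chain-coherent : ∀ c {zs} → Linked _<_ zs → AllPairs CoherentPair (chain c zs)
chain-coherent c []                       = []
chain-coherent c [-]                      = []
chain-coherent c {a ∷ b ∷ rest} (a<b ∷ rs) =
  All.map (λ b≤src src<b → ⊥-elim (<-irrefl refl (<-≤-trans src<b b≤src))) (chain-src-≥ c rest rs)
  ∷ chain-coherent c rs

chain-in-target-coherent : ∀ i j a ws → All (CoherentPair ⟨ i ⟶ j ∣ a ⟩) (chain j ws)
chain-in-target-coherent i j a []            = []
chain-in-target-coherent i j a (w ∷ [])      = []
chain-in-target-coherent i j a (w ∷ w' ∷ ws) =
  (λ _ → inj₁ refl) ∷ chain-in-target-coherent i j a (w' ∷ ws)

-- Equivalent to CoherentPair s ⟨ z ⟶ z' ∣ c ⟩ whenever c ≢ tgt s.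
CoherentSource : EStep → ℕ → Set
CoherentSource s z = z < tgt s → z ≡ oth s

chain-coherent⁺ : ∀ s c {zs} → All (CoherentSource s) zs → All (CoherentPair s) (chain c zs)
chain-coherent⁺ s c []                  = []
chain-coherent⁺ s c (_ ∷ [])            = []
chain-coherent⁺ s c (ok ∷ oks@(_ ∷ _)) = (λ z<t → inj₂ (ok z<t)) ∷ chain-coherent⁺ s c oks

coherentPair⇒source : ∀ s t → oth t ≢ tgt s → CoherentPair s t → CoherentSource s (src t)
coherentPair⇒source s t c≢t h z<t with h z<t
... | inj₁ t≡c = ⊥-elim (c≢t (sym t≡c))
... | inj₂ z≡oth = z≡oth

chain-coherent⁻ : ∀ s {c} zs e → c ≢ tgt s → All (CoherentPair s) (chain c (zs ∷ʳ e)) →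
  All (CoherentSource s) zs
chain-coherent⁻ s []            e c≢t _        = []
chain-coherent⁻ s (z ∷ [])      e c≢t (h ∷ _)  = coherentPair⇒source s ⟨ z ⟶ e ∣ _ ⟩ c≢t h ∷ []
chain-coherent⁻ s (z ∷ z' ∷ zs) e c≢t (h ∷ hs) =
  coherentPair⇒source s ⟨ z ⟶ z' ∣ _ ⟩ c≢t h ∷ chain-coherent⁻ s (z' ∷ zs) e c≢t hs

moves-monotone : ∀ o a b X {a₁ b₁} → Linked Move (pt o a b ∷ X) →
  last (pt o a b ∷ X) ≡ just (pt o a₁ b₁) → a ≤ a₁ × b ≤ b₁
moves-monotone o a b [] _ last≡ with pt-injective o (just-injective last≡)
... | refl , refl = ≤-refl , ≤-refl
moves-monotone o a b (r ∷ X) (m ∷ ms) last≡ with move-from o a b m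
... | up {d} b<d with moves-monotone o a d X ms last≡
...   | a≤a₁ , d≤b₁ = a≤a₁ , ≤-trans (<⇒≤ b<d) d≤b₁
moves-monotone o a b (r ∷ X) (m ∷ ms) last≡ | right {c} a<c with moves-monotone o c b X ms last≡
...   | c≤a₁ , b≤b₁ = ≤-trans (<⇒≤ a<c) c≤a₁ , b≤b₁

crossing-step : ∀ o a b X {a₁ b₁} c → Linked Move (pt o a b ∷ X) →
  last (pt o a b ∷ X) ≡ just (pt o a₁ b₁) → a ≤ c → c < a₁ →
  ∃[ s ] (s ∈ steps (pt o a b ∷ X) × src s ≤ c × c < tgt s × tgt s ≤ a₁ × oth s ≤ b₁)
crossing-step o a b [] c _ last≡ a≤c c<a₁ with pt-injective o (just-injective last≡)
... | refl , refl = ⊥-elim (<-irrefl refl (≤-<-trans a≤c c<a₁))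
crossing-step o a b (r ∷ X) c (m ∷ ms) last≡ a≤c c<a₁ with move-from o a b m
... | up {d} _ with crossing-step o a d X c ms last≡ a≤c c<a₁
...   | s , s∈ , bounds = s , there s∈ , bounds
crossing-step o a b (r ∷ X) c (m ∷ ms) last≡ a≤c c<a₁ | right {a'} a<a' with c <? a'
... | yes c<a' = ⟨ a ⟶ a' ∣ b ⟩ , here (sym (step-horizontal o b (<⇒≢ a<a'))) , a≤c , c<a' ,
                 moves-monotone o a' b X ms last≡
... | no c≮a' with crossing-step o a' b X c ms last≡ (≮⇒≥ c≮a') c<a₁
...   | s , s∈ , bounds = s , there s∈ , bounds

steps-inner : ∀ n {X} → All (Inner n) X → All (λ s → tgt s < n) (steps X)
steps-inner n []                    = []
steps-inner n (_ ∷ [])              = []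
steps-inner n {(a , b) ∷ (c , d) ∷ X} (_ ∷ inner@((c<n , d<n) ∷ _)) = tgt< ∷ steps-inner n inner
  where
  tgt< : tgt (step (a , b) (c , d)) < n
  tgt< with a ≟ c
  ... | yes _ = d<n
  ... | no _ = c<n

crossing-from-start : ∀ o {R a₁ b₁} c → head R ≡ just (2 , 1) → Linked Move R →
  last R ≡ just (pt o a₁ b₁) → 2 ≤ c → c < a₁ →
  ∃[ s ] (s ∈ steps R × src s ≤ c × c < tgt s × tgt s ≤ a₁ × oth s ≤ b₁)
crossing-from-start false {_ ∷ X} c refl moves last≡ 2≤c c<a₁ =
  crossing-step false 2 1 X c moves last≡ 2≤c c<a₁
crossing-from-start true  {_ ∷ X} c refl moves last≡ 2≤c c<a₁ =
  crossing-step true 1 2 X c moves last≡ (≤-trans (s≤s z≤n) 2≤c) c<a₁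

-- Computing restrictions

clampC-≢ : ∀ n {x} → x ≢ suc n → clampC n x ≡ x
clampC-≢ n {x} x≢ with x ≟ suc n
... | yes x≡ = ⊥-elim (x≢ x≡)
... | no _ = refl

clampC-< : ∀ n {x} → x < suc n → clampC n x ≡ x
clampC-< n x< = clampC-≢ n (<⇒≢ x<)

clampC-suc : ∀ n → clampC n (suc n) ≡ n
clampC-suc n with suc n ≟ suc n
... | yes _ = refl
... | no ≢ = ⊥-elim (≢ refl)

clampC-n : ∀ n → clampC n n ≡ n
clampC-n n = clampC-< n (n<1+n n)

clampP-pt : ∀ n o {a b a' b'} → clampC n a ≡ a' → clampC n b ≡ b' → clampP n (pt o a b) ≡ pt o a' b'
clampP-pt n false refl refl = refl
clampP-pt n true  refl refl = refl

map-clampP-inner : ∀ n {P} → All (Inner n) P → map (clampP n) P ≡ P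
map-clampP-inner n []                         = refl
map-clampP-inner n ((a<n , b<n) ∷ inner) =
  cong₂ _∷_ (cong₂ _,_ (clampC-< n (m<n⇒m<1+n a<n)) (clampC-< n (m<n⇒m<1+n b<n)))
            (map-clampP-inner n inner)

clampP-column : ∀ n o {c e} zs → clampC n c ≡ n → clampC n e ≡ n → All (_< suc n) zs →
  map (clampP n) (map (pt o c) (zs ∷ʳ e)) ≡ map (pt o n) (zs ∷ʳ n)
clampP-column n o []       c≡ e≡ []          = cong [_] (clampP-pt n o c≡ e≡)
clampP-column n o (z ∷ zs) c≡ e≡ (z< ∷ zs<) =
  cong₂ _∷_ (clampP-pt n o c≡ (clampC-< n z<)) (clampP-column n o zs c≡ e≡ zs<)

newLast-column : ∀ n o {y} r → y ≢ n → newLast n (pt o n y) r ≡ pt o n (n ∸ 1)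
newLast-column n false {y} r y≢n with y ≟ n
... | yes y≡n = ⊥-elim (y≢n y≡n)
... | no _ with n ≟ n
...   | yes _ = refl
...   | no ≢ = ⊥-elim (≢ refl)
newLast-column n true r y≢n with n ≟ n
... | yes _ = refl
... | no ≢ = ⊥-elim (≢ refl)

fixLast-++ : ∀ n (P : List Pt) q t T → fixLast n (P ++ q ∷ t ∷ T) ≡ P ++ fixLast n (q ∷ t ∷ T)
fixLast-++ n []                 q t T = refl
fixLast-++ n (p ∷ [])           q t T = refl
fixLast-++ n (p ∷ p' ∷ [])      q t T = cong (p ∷_) (fixLast-++ n (p' ∷ []) q t T)
fixLast-++ n (p ∷ p' ∷ p'' ∷ P) q t T = cong (p ∷_) (fixLast-++ n (p' ∷ p'' ∷ P) q t T)

fixLast-column : ∀ n o q {y} zs → All (_≢ n) (y ∷ zs) →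
  fixLast n (q ∷ map (pt o n) (y ∷ zs ∷ʳ n)) ≡ q ∷ map (pt o n) (y ∷ zs ∷ʳ (n ∸ 1))
fixLast-column n o q []       (y≢n ∷ [])   = cong (λ r → q ∷ pt o n _ ∷ [ r ]) (newLast-column n o _ y≢n)
fixLast-column n o q (z ∷ zs) (_ ∷ z∷zs≢n) = cong (q ∷_) (fixLast-column n o (pt o n _) zs z∷zs≢n)

consNR-≡ : ∀ p ys → consNR p (p ∷ ys) ≡ p ∷ ys
consNR-≡ p ys with p ≟ₚ p
... | yes _ = refl
... | no ≢ = ⊥-elim (≢ refl)

consNR-≢ : ∀ {p q} ys → p ≢ q → consNR p (q ∷ ys) ≡ p ∷ q ∷ ys
consNR-≢ {p} {q} ys p≢q with p ≟ₚ q
... | yes p≡q = ⊥-elim (p≢q p≡q)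
... | no _ = refl

consNR-idem : ∀ p Z → consNR p (consNR p Z) ≡ consNR p Z
consNR-idem p []       = consNR-≡ p []
consNR-idem p (q ∷ ys) with p ≟ₚ q
... | yes refl = consNR-≡ p ys
... | no _ = consNR-≡ p (q ∷ ys)

dedup-id : ∀ {xs} → Linked _≢_ xs → dedup xs ≡ xs
dedup-id []                 = refl
dedup-id [-]                = refl
dedup-id {p ∷ q ∷ xs} (p≢q ∷ rs) rewrite dedup-id rs = consNR-≢ xs p≢q

dedup-repeat : ∀ A p B → dedup (A ++ p ∷ p ∷ B) ≡ dedup (A ++ p ∷ B)
dedup-repeat []      p B = consNR-idem p (dedup B)
dedup-repeat (a ∷ A) p B = cong (consNR a) (dedup-repeat A p B)

dedup-++ : ∀ P {X q Y} → dedup X ≡ q ∷ Y → Linked _≢_ (P ∷ʳ q) → dedup (P ++ X) ≡ P ++ q ∷ Y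
dedup-++ []           X≡ _          = X≡
dedup-++ (p ∷ [])     X≡ (p≢q ∷ _)  rewrite X≡ = consNR-≢ _ p≢q
dedup-++ (p ∷ p' ∷ P) {X} X≡ (p≢p' ∷ rs) rewrite dedup-++ (p' ∷ P) {X} X≡ rs = consNR-≢ _ p≢p'

restrict-++ : ∀ n P q t T {Y} → All (Inner n) (P ∷ʳ q) → Linked _≢_ (P ∷ʳ q) →
  dedup (fixLast n (q ∷ clampP n t ∷ map (clampP n) T)) ≡ q ∷ Y →
  restrict n (P ++ q ∷ t ∷ T) ≡ P ++ q ∷ Y
restrict-++ n P q t T {Y} inner distinct tail≡ = begin
  dedup (fixLast n (map (clampP n) (P ++ q ∷ t ∷ T)))
    ≡⟨ cong (dedup ∘ fixLast n) clamped ⟩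
  dedup (fixLast n (P ++ q ∷ clampP n t ∷ map (clampP n) T))
    ≡⟨ cong dedup (fixLast-++ n P q (clampP n t) (map (clampP n) T)) ⟩
  dedup (P ++ fixLast n (q ∷ clampP n t ∷ map (clampP n) T))
    ≡⟨ dedup-++ P tail≡ distinct ⟩
  P ++ q ∷ Y ∎
  where
  open ≡-Reasoning
  clamped : map (clampP n) (P ++ q ∷ t ∷ T) ≡ P ++ q ∷ clampP n t ∷ map (clampP n) T
  clamped = begin
    map (clampP n) (P ++ q ∷ t ∷ T)              ≡⟨ cong (map (clampP n)) (sym (++-assoc P [ q ] (t ∷ T))) ⟩
    map (clampP n) ((P ∷ʳ q) ++ t ∷ T)           ≡⟨ map-++ (clampP n) (P ∷ʳ q) (t ∷ T) ⟩
    map (clampP n) (P ∷ʳ q) ++ map (clampP n) (t ∷ T) ≡⟨ cong (_++ _) (map-clampP-inner n inner) ⟩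
    (P ∷ʳ q) ++ map (clampP n) (t ∷ T)           ≡⟨ ++-assoc P [ q ] _ ⟩
    P ++ q ∷ clampP n t ∷ map (clampP n) T       ∎

-- Telling the twelve cases apart

lastStep : List EStep → EStep
lastStep []           = ⟨ 0 ⟶ 0 ∣ 0 ⟩
lastStep (s ∷ [])     = s
lastStep (_ ∷ s ∷ ss) = lastStep (s ∷ ss)

penultimateStep : List EStep → EStep
penultimateStep (s ∷ _ ∷ [])      = s
penultimateStep (_ ∷ s ∷ s' ∷ ss) = penultimateStep (s ∷ s' ∷ ss)
penultimateStep _                 = ⟨ 0 ⟶ 0 ∣ 0 ⟩

lastStep-∷ʳ : ∀ ss s → lastStep (ss ∷ʳ s) ≡ s
lastStep-∷ʳ []           s = refl
lastStep-∷ʳ (_ ∷ [])     s = refl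
lastStep-∷ʳ (_ ∷ s' ∷ ss) s = lastStep-∷ʳ (s' ∷ ss) s

lastStep-∷ʳ₂ : ∀ ss s s' → lastStep (ss ++ s ∷ s' ∷ []) ≡ s'
lastStep-∷ʳ₂ ss s s' rewrite sym (++-assoc ss [ s ] [ s' ]) = lastStep-∷ʳ (ss ∷ʳ s) s'

penultimateStep-∷ʳ₂ : ∀ ss s s' → penultimateStep (ss ++ s ∷ s' ∷ []) ≡ s
penultimateStep-∷ʳ₂ []                s s' = refl
penultimateStep-∷ʳ₂ (_ ∷ [])          s s' = refl
penultimateStep-∷ʳ₂ (_ ∷ t ∷ [])      s s' = refl
penultimateStep-∷ʳ₂ (_ ∷ t ∷ t' ∷ ss) s s' = penultimateStep-∷ʳ₂ (t ∷ t' ∷ ss) s s'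

lastStep-++-∷ʳ : ∀ ss ts s → lastStep (ss ++ ts ∷ʳ s) ≡ s
lastStep-++-∷ʳ ss ts s rewrite sym (++-assoc ss ts [ s ]) = lastStep-∷ʳ (ss ++ ts) s

lastStep-++-∷ʳ₂ : ∀ ss ts s s' → lastStep (ss ++ ts ++ s ∷ s' ∷ []) ≡ s'
lastStep-++-∷ʳ₂ ss ts s s' rewrite sym (++-assoc ss ts (s ∷ s' ∷ [])) = lastStep-∷ʳ₂ (ss ++ ts) s s'

penultimateStep-++-∷ʳ₂ : ∀ ss ts s s' → penultimateStep (ss ++ ts ++ s ∷ s' ∷ []) ≡ s
penultimateStep-++-∷ʳ₂ ss ts s s' rewrite sym (++-assoc ss ts (s ∷ s' ∷ [])) =
  penultimateStep-∷ʳ₂ (ss ++ ts) s s'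

penultimateStep-chain : ∀ ss s c y mid w s' →
  tgt (penultimateStep (ss ++ s ∷ chain c (y ∷ mid ∷ʳ w) ++ [ s' ])) ≡ w
penultimateStep-chain ss s c y mid w s' with last-∷ y mid
... | p , last≡
  rewrite chain-∷ʳ c (y ∷ mid) w last≡ | ++-assoc (chain c (y ∷ mid)) [ ⟨ p ⟶ w ∣ c ⟩ ] [ s' ] =
  cong tgt (penultimateStep-++-∷ʳ₂ ss (s ∷ chain c (y ∷ mid)) _ s')

infix 4 _==_

_==_ : ℕ → ℕ → Bool
m == k = does (m ≟ k)

==-refl : ∀ m → (m == m) ≡ true
==-refl m = dec-true (m ≟ m) refl

==-≢ : ∀ {m k} → m ≢ k → (m == k) ≡ false
==-≢ {m} {k} = dec-false (m ≟ k)

classify : ℕ → List EStep → List EStep → CaseLabel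
classify n S S' =
  if oth (lastStep S') == n ∸ 1
    then (if oth final == n then i-a else if src (penultimateStep S) == n then i-b else i-c)
  else if tgt (penultimateStep S') == n
    then (if oth final == n then (if src final == n ∸ 1 then iii-a else iii-b)
          else if src final == n ∸ 1 then iii-d
          else if src (penultimateStep S) == n then iii-c else iii-e)
  else if src final == n ∸ 1 then (if oth final == n then ii-a else ii-c)
  else (if oth final == n then ii-b else ii-d)
  where
  final : EStep
  final = lastStep S

module _ {n : ℕ} (0<n : 0 < n) where

  private
    n≢n∸1 : n ≢ n ∸ 1
    n≢n∸1 = >⇒≢ (∸1< 0<n)

    <n∸1⇒≢n : ∀ {w} → w < n ∸ 1 → w ≢ n
    <n∸1⇒≢n w< = <⇒≢ (<-trans w< (∸1< 0<n))

  i-a⇒classify : ∀ {S S'} → Case n S S' i-a → classify n S S' ≡ i-a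
  i-a⇒classify (x , Sp , _ , refl , refl)
    rewrite lastStep-∷ʳ Sp ⟨ x ⟶ n ∣ n ∸ 1 ⟩
          | lastStep-∷ʳ (Sp ∷ʳ ⟨ x ⟶ n ∣ n ∸ 1 ⟩) ⟨ n ∸ 1 ⟶ suc n ∣ n ⟩
          | ==-refl (n ∸ 1) | ==-refl n = refl

  i-b⇒classify : ∀ {S S'} → Case n S S' i-b → classify n S S' ≡ i-b
  i-b⇒classify (x , Sp , _ , refl , refl)
    rewrite lastStep-∷ʳ Sp ⟨ x ⟶ n ∣ n ∸ 1 ⟩
          | lastStep-∷ʳ₂ (Sp ∷ʳ ⟨ x ⟶ n ∣ n ∸ 1 ⟩) ⟨ n ⟶ suc n ∣ n ∸ 1 ⟩ ⟨ n ∸ 1 ⟶ n ∣ suc n ⟩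
          | penultimateStep-∷ʳ₂ (Sp ∷ʳ ⟨ x ⟶ n ∣ n ∸ 1 ⟩) ⟨ n ⟶ suc n ∣ n ∸ 1 ⟩ ⟨ n ∸ 1 ⟶ n ∣ suc n ⟩
          | ==-refl (n ∸ 1) | ==-≢ (1+n≢n {n}) | ==-refl n = refl

  i-c⇒classify : ∀ {S S'} → Case n S S' i-c → classify n S S' ≡ i-c
  i-c⇒classify (x , Sp , x< , refl , refl)
    rewrite lastStep-∷ʳ Sp ⟨ x ⟶ n ∣ n ∸ 1 ⟩
          | lastStep-∷ʳ₂ Sp ⟨ x ⟶ suc n ∣ n ∸ 1 ⟩ ⟨ n ∸ 1 ⟶ n ∣ suc n ⟩
          | penultimateStep-∷ʳ₂ Sp ⟨ x ⟶ suc n ∣ n ∸ 1 ⟩ ⟨ n ∸ 1 ⟶ n ∣ suc n ⟩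
          | ==-refl (n ∸ 1) | ==-≢ (1+n≢n {n}) | ==-≢ (<n∸1⇒≢n x<) = refl

  ii-a⇒classify : ∀ {S S'} → Case n S S' ii-a → classify n S S' ≡ ii-a
  ii-a⇒classify (x , y , mid , w , Sp , _ , lk , refl , refl)
    rewrite lastStep-∷ʳ (Sp ++ ⟨ x ⟶ n ∣ y ⟩ ∷ chain n (y ∷ mid ∷ʳ w) ++ [ ⟨ w ⟶ n ∸ 1 ∣ n ⟩ ]) ⟨ n ∸ 1 ⟶ suc n ∣ n ⟩
          | lastStep-++-∷ʳ Sp (⟨ x ⟶ n ∣ y ⟩ ∷ chain n (y ∷ mid ∷ʳ w)) ⟨ w ⟶ n ∸ 1 ∣ n ⟩
          | penultimateStep-chain Sp ⟨ x ⟶ n ∣ y ⟩ n y mid w ⟨ w ⟶ n ∸ 1 ∣ n ⟩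
          | ==-≢ n≢n∸1 | ==-≢ (<n∸1⇒≢n (linked-∷ʳ₂ (y ∷ mid) lk)) | ==-refl (n ∸ 1) | ==-refl n = refl

  ii-b⇒classify : ∀ {S S'} → Case n S S' ii-b → classify n S S' ≡ ii-b
  ii-b⇒classify (x , y , mid , w , Sp , _ , lk , refl , refl)
    rewrite lastStep-++-∷ʳ Sp (⟨ x ⟶ n ∣ y ⟩ ∷ chain n (y ∷ mid ∷ʳ w)) ⟨ w ⟶ suc n ∣ n ⟩
          | lastStep-++-∷ʳ Sp (⟨ x ⟶ n ∣ y ⟩ ∷ chain n (y ∷ mid ∷ʳ w)) ⟨ w ⟶ n ∸ 1 ∣ n ⟩
          | penultimateStep-chain Sp ⟨ x ⟶ n ∣ y ⟩ n y mid w ⟨ w ⟶ n ∸ 1 ∣ n ⟩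
          | ==-≢ n≢n∸1 | ==-≢ (<n∸1⇒≢n (linked-∷ʳ₂ (y ∷ mid) lk))
          | ==-≢ (<⇒≢ (linked-∷ʳ₂ (y ∷ mid) lk)) | ==-refl n = refl

  ii-c⇒classify : ∀ {S S'} → Case n S S' ii-c → classify n S S' ≡ ii-c
  ii-c⇒classify (x , y , mid , w , Sp , _ , lk , refl , refl)
    rewrite lastStep-++-∷ʳ₂ Sp (⟨ x ⟶ suc n ∣ y ⟩ ∷ chain (suc n) (y ∷ mid ∷ʳ w)) ⟨ w ⟶ n ∸ 1 ∣ suc n ⟩ ⟨ n ∸ 1 ⟶ n ∣ suc n ⟩
          | lastStep-++-∷ʳ Sp (⟨ x ⟶ n ∣ y ⟩ ∷ chain n (y ∷ mid ∷ʳ w)) ⟨ w ⟶ n ∸ 1 ∣ n ⟩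
          | penultimateStep-chain Sp ⟨ x ⟶ n ∣ y ⟩ n y mid w ⟨ w ⟶ n ∸ 1 ∣ n ⟩
          | ==-≢ n≢n∸1 | ==-≢ (<n∸1⇒≢n (linked-∷ʳ₂ (y ∷ mid) lk))
          | ==-refl (n ∸ 1) | ==-≢ (1+n≢n {n}) = refl

  ii-d⇒classify : ∀ {S S'} → Case n S S' ii-d → classify n S S' ≡ ii-d
  ii-d⇒classify (x , y , mid , w , Sp , _ , lk , refl , refl)
    rewrite lastStep-++-∷ʳ Sp (⟨ x ⟶ suc n ∣ y ⟩ ∷ chain (suc n) (y ∷ mid ∷ʳ w)) ⟨ w ⟶ n ∣ suc n ⟩
          | lastStep-++-∷ʳ Sp (⟨ x ⟶ n ∣ y ⟩ ∷ chain n (y ∷ mid ∷ʳ w)) ⟨ w ⟶ n ∸ 1 ∣ n ⟩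
          | penultimateStep-chain Sp ⟨ x ⟶ n ∣ y ⟩ n y mid w ⟨ w ⟶ n ∸ 1 ∣ n ⟩
          | ==-≢ n≢n∸1 | ==-≢ (<n∸1⇒≢n (linked-∷ʳ₂ (y ∷ mid) lk))
          | ==-≢ (<⇒≢ (linked-∷ʳ₂ (y ∷ mid) lk)) | ==-≢ (1+n≢n {n}) = refl

  iii-a⇒classify : ∀ {S S'} → Case n S S' iii-a → classify n S S' ≡ iii-a
  iii-a⇒classify (x , y , Sp , _ , _ , refl , refl)
    rewrite lastStep-∷ʳ (Sp ++ ⟨ x ⟶ n ∣ y ⟩ ∷ ⟨ y ⟶ n ∸ 1 ∣ n ⟩ ∷ []) ⟨ n ∸ 1 ⟶ suc n ∣ n ⟩
          | lastStep-∷ʳ₂ Sp ⟨ x ⟶ n ∣ y ⟩ ⟨ y ⟶ n ∸ 1 ∣ n ⟩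
          | penultimateStep-∷ʳ₂ Sp ⟨ x ⟶ n ∣ y ⟩ ⟨ y ⟶ n ∸ 1 ∣ n ⟩
          | ==-≢ n≢n∸1 | ==-refl n | ==-refl (n ∸ 1) = refl

  iii-b⇒classify : ∀ {S S'} → Case n S S' iii-b → classify n S S' ≡ iii-b
  iii-b⇒classify (x , y , Sp , _ , y< , refl , refl)
    rewrite lastStep-∷ʳ₂ Sp ⟨ x ⟶ n ∣ y ⟩ ⟨ y ⟶ suc n ∣ n ⟩
          | lastStep-∷ʳ₂ Sp ⟨ x ⟶ n ∣ y ⟩ ⟨ y ⟶ n ∸ 1 ∣ n ⟩
          | penultimateStep-∷ʳ₂ Sp ⟨ x ⟶ n ∣ y ⟩ ⟨ y ⟶ n ∸ 1 ∣ n ⟩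
          | ==-≢ n≢n∸1 | ==-refl n | ==-≢ (<⇒≢ y<) = refl

  iii-c⇒classify : ∀ {S S'} → Case n S S' iii-c → classify n S S' ≡ iii-c
  iii-c⇒classify (x , y , Sp , _ , y< , refl , refl)
    rewrite lastStep-++-∷ʳ₂ Sp [ ⟨ x ⟶ n ∣ y ⟩ ] ⟨ n ⟶ suc n ∣ y ⟩ ⟨ y ⟶ n ∣ suc n ⟩
          | penultimateStep-++-∷ʳ₂ Sp [ ⟨ x ⟶ n ∣ y ⟩ ] ⟨ n ⟶ suc n ∣ y ⟩ ⟨ y ⟶ n ∣ suc n ⟩
          | lastStep-∷ʳ₂ Sp ⟨ x ⟶ n ∣ y ⟩ ⟨ y ⟶ n ∸ 1 ∣ n ⟩
          | penultimateStep-∷ʳ₂ Sp ⟨ x ⟶ n ∣ y ⟩ ⟨ y ⟶ n ∸ 1 ∣ n ⟩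
          | ==-≢ n≢n∸1 | ==-refl n | ==-≢ (1+n≢n {n}) | ==-≢ (<⇒≢ y<) = refl

  iii-d⇒classify : ∀ {S S'} → Case n S S' iii-d → classify n S S' ≡ iii-d
  iii-d⇒classify (x , y , Sp , _ , _ , refl , refl)
    rewrite lastStep-++-∷ʳ₂ Sp [ ⟨ x ⟶ suc n ∣ y ⟩ ] ⟨ y ⟶ n ∸ 1 ∣ suc n ⟩ ⟨ n ∸ 1 ⟶ n ∣ suc n ⟩
          | lastStep-∷ʳ₂ Sp ⟨ x ⟶ n ∣ y ⟩ ⟨ y ⟶ n ∸ 1 ∣ n ⟩
          | penultimateStep-∷ʳ₂ Sp ⟨ x ⟶ n ∣ y ⟩ ⟨ y ⟶ n ∸ 1 ∣ n ⟩
          | ==-≢ n≢n∸1 | ==-refl n | ==-≢ (1+n≢n {n}) | ==-refl (n ∸ 1) = refl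

  iii-e⇒classify : ∀ {S S'} → Case n S S' iii-e → classify n S S' ≡ iii-e
  iii-e⇒classify (x , y , Sp , x< , y< , refl , refl)
    rewrite lastStep-∷ʳ₂ Sp ⟨ x ⟶ suc n ∣ y ⟩ ⟨ y ⟶ n ∣ suc n ⟩
          | penultimateStep-∷ʳ₂ Sp ⟨ x ⟶ suc n ∣ y ⟩ ⟨ y ⟶ n ∣ suc n ⟩
          | lastStep-∷ʳ₂ Sp ⟨ x ⟶ n ∣ y ⟩ ⟨ y ⟶ n ∸ 1 ∣ n ⟩
          | penultimateStep-∷ʳ₂ Sp ⟨ x ⟶ n ∣ y ⟩ ⟨ y ⟶ n ∸ 1 ∣ n ⟩
          | ==-≢ n≢n∸1 | ==-refl n | ==-≢ (1+n≢n {n}) | ==-≢ (<⇒≢ y<) | ==-≢ (<⇒≢ x<) = refl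

  case⇒classify : ∀ c {S S'} → Case n S S' c → classify n S S' ≡ c
  case⇒classify i-a   = i-a⇒classify
  case⇒classify i-b   = i-b⇒classify
  case⇒classify i-c   = i-c⇒classify
  case⇒classify ii-a  = ii-a⇒classify
  case⇒classify ii-b  = ii-b⇒classify
  case⇒classify ii-c  = ii-c⇒classify
  case⇒classify ii-d  = ii-d⇒classify
  case⇒classify iii-a = iii-a⇒classify
  case⇒classify iii-b = iii-b⇒classify
  case⇒classify iii-c = iii-c⇒classify
  case⇒classify iii-d = iii-d⇒classify
  case⇒classify iii-e = iii-e⇒classify

  case-unique : ∀ c d {S S'} → Case n S S' c → Case n S S' d → d ≡ c
  case-unique c d hc hd = trans (sym (case⇒classify d hd)) (case⇒classify c hc)

module _ (n : ℕ) (Sp : List EStep) (x : ℕ) where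

  private
    S′ : ℕ → List ℕ → List EStep
    S′ y rs = Sp ++ ⟨ x ⟶ n ∣ y ⟩ ∷ chain n (y ∷ rs)

    ++-∷ʳ : ∀ s ss s' → Sp ++ s ∷ ss ∷ʳ s' ≡ (Sp ++ s ∷ ss) ∷ʳ s'
    ++-∷ʳ s ss s' = sym (++-assoc Sp (s ∷ ss) [ s' ])

    chain-top : ∀ c y mid w b →
      chain c (y ∷ mid ++ w ∷ b ∷ []) ≡ chain c (y ∷ mid ∷ʳ w) ∷ʳ ⟨ w ⟶ b ∣ c ⟩
    chain-top c y mid w b = chain-++ c (y ∷ mid) w [ b ]

    chain-top₂ : ∀ c y mid w b b' →
      chain c (y ∷ (mid ++ w ∷ b ∷ []) ∷ʳ b') ≡
      chain c (y ∷ mid ∷ʳ w) ++ ⟨ w ⟶ b ∣ c ⟩ ∷ ⟨ b ⟶ b' ∣ c ⟩ ∷ []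
    chain-top₂ c y mid w b b' rewrite ++-assoc mid (w ∷ b ∷ []) [ b' ] = chain-++ c (y ∷ mid) w (b ∷ b' ∷ [])

  i-a-case : ∀ {y} → y ≡ n ∸ 1 → x < n ∸ 1 →
    Case n (Sp ++ ⟨ x ⟶ n ∣ y ⟩ ∷ chain n (y ∷ [ suc n ])) (S′ y []) i-a
  i-a-case refl x< = x , Sp , x< , refl , ++-∷ʳ _ [] _

  i-b-case : ∀ {y} → y ≡ n ∸ 1 → x < n ∸ 1 →
    Case n (Sp ++ ⟨ x ⟶ n ∣ y ⟩ ∷ ⟨ n ⟶ suc n ∣ y ⟩ ∷ ⟨ y ⟶ n ∣ suc n ⟩ ∷ []) (S′ y []) i-b
  i-b-case refl x< = x , Sp , x< , refl , sym (++-assoc Sp [ _ ] (_ ∷ _ ∷ []))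

  i-c-case : ∀ {y} → y ≡ n ∸ 1 → x < n ∸ 1 →
    Case n (Sp ++ ⟨ x ⟶ suc n ∣ y ⟩ ∷ chain (suc n) (y ∷ [ n ])) (S′ y []) i-c
  i-c-case refl x< = x , Sp , x< , refl , refl

  ii-a-case : ∀ {y} mid w → x < n ∸ 1 → Linked _<_ (y ∷ mid ++ w ∷ n ∸ 1 ∷ []) →
    Case n (Sp ++ ⟨ x ⟶ n ∣ y ⟩ ∷ chain n (y ∷ (mid ++ w ∷ n ∸ 1 ∷ []) ∷ʳ suc n))
           (S′ y (mid ++ w ∷ n ∸ 1 ∷ [])) ii-a
  ii-a-case {y} mid w x< lk = x , y , mid , w , Sp , x< , lk ,
    cong (λ C → Sp ++ ⟨ x ⟶ n ∣ y ⟩ ∷ C) (chain-top n y mid w (n ∸ 1)) ,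
    trans (cong (λ C → Sp ++ ⟨ x ⟶ n ∣ y ⟩ ∷ C)
                (chain-∷ʳ n (y ∷ mid ++ w ∷ n ∸ 1 ∷ []) (suc n) (last-++ (y ∷ mid) w _)))
          (++-∷ʳ _ _ _)

  ii-b-case : ∀ {y} mid w → x < n ∸ 1 → Linked _<_ (y ∷ mid ++ w ∷ n ∸ 1 ∷ []) →
    Case n (Sp ++ ⟨ x ⟶ n ∣ y ⟩ ∷ chain n (y ∷ mid ∷ʳ w ∷ʳ suc n))
           (S′ y (mid ++ w ∷ n ∸ 1 ∷ [])) ii-b
  ii-b-case {y} mid w x< lk = x , y , mid , w , Sp , x< , lk ,
    cong (λ C → Sp ++ ⟨ x ⟶ n ∣ y ⟩ ∷ C) (chain-top n y mid w (n ∸ 1)) ,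
    cong (λ C → Sp ++ ⟨ x ⟶ n ∣ y ⟩ ∷ C) (chain-∷ʳ n (y ∷ mid ∷ʳ w) (suc n) (last-∷ʳ (y ∷ mid) w))

  ii-c-case : ∀ {y} mid w → x < n ∸ 1 → Linked _<_ (y ∷ mid ++ w ∷ n ∸ 1 ∷ []) →
    Case n (Sp ++ ⟨ x ⟶ suc n ∣ y ⟩ ∷ chain (suc n) (y ∷ (mid ++ w ∷ n ∸ 1 ∷ []) ∷ʳ n))
           (S′ y (mid ++ w ∷ n ∸ 1 ∷ [])) ii-c
  ii-c-case {y} mid w x< lk = x , y , mid , w , Sp , x< , lk ,
    cong (λ C → Sp ++ ⟨ x ⟶ n ∣ y ⟩ ∷ C) (chain-top n y mid w (n ∸ 1)) ,
    cong (λ C → Sp ++ ⟨ x ⟶ suc n ∣ y ⟩ ∷ C) (chain-top₂ (suc n) y mid w (n ∸ 1) n)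

  ii-d-case : ∀ {y} mid w → x < n ∸ 1 → Linked _<_ (y ∷ mid ++ w ∷ n ∸ 1 ∷ []) →
    Case n (Sp ++ ⟨ x ⟶ suc n ∣ y ⟩ ∷ chain (suc n) (y ∷ mid ∷ʳ w ∷ʳ n))
           (S′ y (mid ++ w ∷ n ∸ 1 ∷ [])) ii-d
  ii-d-case {y} mid w x< lk = x , y , mid , w , Sp , x< , lk ,
    cong (λ C → Sp ++ ⟨ x ⟶ n ∣ y ⟩ ∷ C) (chain-top n y mid w (n ∸ 1)) ,
    cong (λ C → Sp ++ ⟨ x ⟶ suc n ∣ y ⟩ ∷ C) (chain-∷ʳ (suc n) (y ∷ mid ∷ʳ w) n (last-∷ʳ (y ∷ mid) w))

  iii-a-case : ∀ {y} → x < n → y < n ∸ 1 →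
    Case n (Sp ++ ⟨ x ⟶ n ∣ y ⟩ ∷ chain n (y ∷ n ∸ 1 ∷ [ suc n ])) (S′ y [ n ∸ 1 ]) iii-a
  iii-a-case {y} x< y< = x , y , Sp , x< , y< , refl , ++-∷ʳ _ [ _ ] _

  iii-b-case : ∀ {y} → x < n → y < n ∸ 1 →
    Case n (Sp ++ ⟨ x ⟶ n ∣ y ⟩ ∷ chain n (y ∷ [ suc n ])) (S′ y [ n ∸ 1 ]) iii-b
  iii-b-case {y} x< y< = x , y , Sp , x< , y< , refl , refl

  iii-c-case : ∀ {y} → x < n → y < n ∸ 1 →
    Case n (Sp ++ ⟨ x ⟶ n ∣ y ⟩ ∷ ⟨ n ⟶ suc n ∣ y ⟩ ∷ ⟨ y ⟶ n ∣ suc n ⟩ ∷ [])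
           (S′ y [ n ∸ 1 ]) iii-c
  iii-c-case {y} x< y< = x , y , Sp , x< , y< , refl , refl

  iii-d-case : ∀ {y} → x < n → y < n ∸ 1 →
    Case n (Sp ++ ⟨ x ⟶ suc n ∣ y ⟩ ∷ chain (suc n) (y ∷ n ∸ 1 ∷ [ n ])) (S′ y [ n ∸ 1 ]) iii-d
  iii-d-case {y} x< y< = x , y , Sp , x< , y< , refl , refl

  iii-e-case : ∀ {y} → x < n → y < n ∸ 1 →
    Case n (Sp ++ ⟨ x ⟶ suc n ∣ y ⟩ ∷ chain (suc n) (y ∷ [ n ])) (S′ y [ n ∸ 1 ]) iii-e
  iii-e-case {y} x< y< = x , y , Sp , x< , y< , refl , refl

-- Column n y zs rs: the heights y ∷ zs climbed by L after leaving [n-1]² become the heights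
-- y ∷ rs of the last column of L'.  top is case (i), two-… case (iii), many-… case (ii); in the
-- …-added views the restriction adds height n - 1, in the …-reached views L climbs to it itself.
data Column (n y : ℕ) : List ℕ → List ℕ → Set where
  top          : y ≡ n ∸ 1 → Column n y [] []
  two-added    : y < n ∸ 1 → Column n y [] [ n ∸ 1 ]
  two-reached  : y < n ∸ 1 → Column n y [ n ∸ 1 ] [ n ∸ 1 ]
  many-reached : ∀ mid w → Linked _<_ (y ∷ mid ++ w ∷ n ∸ 1 ∷ []) →
                 Column n y (mid ++ w ∷ n ∸ 1 ∷ []) (mid ++ w ∷ n ∸ 1 ∷ [])
  many-added   : ∀ mid w → Linked _<_ (y ∷ mid ++ w ∷ n ∸ 1 ∷ []) →
                 Column n y (mid ∷ʳ w) (mid ++ w ∷ n ∸ 1 ∷ [])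

column : ∀ {n y} zs → Linked _<_ (y ∷ zs) → All (_< n) (y ∷ zs) → ∃[ rs ] Column n y zs rs
column {n} {y} zs lk (y<n ∷ zs<n) with initLast zs
... | [] with m≤n⇒m<n∨m≡n (<⇒≤∸1 y<n)
...   | inj₁ y< = _ , two-added y<
...   | inj₂ y≡ = _ , top y≡
column {n} {y} _ lk (_ ∷ zs<n) | zs ∷ʳ′ l with m≤n⇒m<n∨m≡n (<⇒≤∸1 (proj₂ (All-∷ʳ⁻ zs zs<n)))
... | inj₁ l< = _ , many-added zs l (linked-join (y ∷ zs) l lk (l< ∷ [-]))
... | inj₂ refl with initLast zs
...   | [] = _ , two-reached (linked-∷ʳ₂ [] lk)
...   | mid ∷ʳ′ w = _ , subst (λ zs → Column n y zs zs) (sym reassoc)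
                          (many-reached mid w (subst (λ zs → Linked _<_ (y ∷ zs)) reassoc lk))
  where
  reassoc : (mid ∷ʳ w) ∷ʳ (n ∸ 1) ≡ mid ++ w ∷ n ∸ 1 ∷ []
  reassoc = ++-assoc mid [ w ] [ n ∸ 1 ]

column-linked : ∀ {n y zs rs} → Column n y zs rs → Linked _<_ (y ∷ rs)
column-linked (top _)               = [-]
column-linked (two-added y<)        = y< ∷ [-]
column-linked (two-reached y<)      = y< ∷ [-]
column-linked (many-reached _ _ lk) = lk
column-linked (many-added _ _ lk)   = lk

column-last : ∀ {n y zs rs} → Column n y zs rs → last (y ∷ rs) ≡ just (n ∸ 1)
column-last (top y≡)                       = cong just y≡
column-last (two-added _)                  = refl
column-last (two-reached _)                = refl
column-last {y = y} (many-reached mid w _) = last-++ (y ∷ mid) w _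
column-last {y = y} (many-added mid w _)   = last-++ (y ∷ mid) w _

column-All : ∀ {n y zs rs} {P : ℕ → Set} → Column n y zs rs →
  All P (y ∷ zs) → P (n ∸ 1) → All P (y ∷ rs)
column-All (top _)              all _ = all
column-All (two-added _)        all p = All.++⁺ all (p ∷ [])
column-All (two-reached _)      all _ = all
column-All (many-reached _ _ _) all _ = all
column-All {n} {y} {P = P} (many-added mid w _) all p =
  subst (λ zs → All P (y ∷ zs)) (++-assoc mid [ w ] [ n ∸ 1 ]) (All.++⁺ all (p ∷ []))

dedup-map-repeat : ∀ q (f : ℕ → Pt) hs a →
  dedup (q ∷ map f ((hs ∷ʳ a) ∷ʳ a)) ≡ dedup (q ∷ map f (hs ∷ʳ a))
dedup-map-repeat q f []       a = dedup-repeat [ q ] (f a) []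
dedup-map-repeat q f (h ∷ hs) a = cong (consNR q) (dedup-map-repeat (f h) f hs a)

column-dedup : ∀ {n y zs rs} o q → Column n y zs rs → Linked _≢_ (q ∷ map (pt o n) (y ∷ rs)) →
  dedup (q ∷ map (pt o n) (y ∷ zs ∷ʳ (n ∸ 1))) ≡ q ∷ map (pt o n) (y ∷ rs)
column-dedup {n} o q (top refl) distinct =
  trans (dedup-map-repeat q (pt o n) [] (n ∸ 1)) (dedup-id distinct)
column-dedup o q (two-added _) distinct = dedup-id distinct
column-dedup {n} {y} o q (two-reached _) distinct =
  trans (dedup-map-repeat q (pt o n) [ y ] (n ∸ 1)) (dedup-id distinct)
column-dedup {n} {y} o q (many-reached mid w _) distinct = begin
  dedup (q ∷ map (pt o n) (y ∷ (mid ++ w ∷ n ∸ 1 ∷ []) ∷ʳ (n ∸ 1)))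
    ≡⟨ cong (λ zs → dedup (q ∷ map (pt o n) (y ∷ zs ∷ʳ (n ∸ 1)))) reassoc ⟩
  dedup (q ∷ map (pt o n) ((y ∷ mid ∷ʳ w ∷ʳ (n ∸ 1)) ∷ʳ (n ∸ 1)))
    ≡⟨ dedup-map-repeat q (pt o n) (y ∷ mid ∷ʳ w) (n ∸ 1) ⟩
  dedup (q ∷ map (pt o n) (y ∷ mid ∷ʳ w ∷ʳ (n ∸ 1)))
    ≡⟨ cong (λ zs → dedup (q ∷ map (pt o n) (y ∷ zs))) (sym reassoc) ⟩
  dedup (q ∷ map (pt o n) (y ∷ mid ++ w ∷ n ∸ 1 ∷ []))
    ≡⟨ dedup-id distinct ⟩
  q ∷ map (pt o n) (y ∷ mid ++ w ∷ n ∸ 1 ∷ []) ∎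
  where
  open ≡-Reasoning
  reassoc : mid ++ w ∷ n ∸ 1 ∷ [] ≡ mid ∷ʳ w ∷ʳ (n ∸ 1)
  reassoc = sym (++-assoc mid [ w ] [ n ∸ 1 ])
column-dedup {n} {y} o q (many-added mid w _) distinct =
  trans (cong (λ zs → dedup (q ∷ map (pt o n) (y ∷ zs))) (++-assoc mid [ w ] [ n ∸ 1 ])) (dedup-id distinct)

-- Leaving [n-1]²

EndsAt : ℕ → List Pt → Set
EndsAt n L = last L ≡ just (n ∸ 1 , n) ⊎ last L ≡ just (n , n ∸ 1)

endsAt-pt : ∀ {n} o c e → EndsAt (suc n) [ pt o c e ] → (c ≡ n × e ≡ suc n) ⊎ (c ≡ suc n × e ≡ n)
endsAt-pt false c e (inj₁ refl) = inj₁ (refl , refl)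
endsAt-pt false c e (inj₂ refl) = inj₂ (refl , refl)
endsAt-pt true  c e (inj₁ refl) = inj₂ (refl , refl)
endsAt-pt true  c e (inj₂ refl) = inj₁ (refl , refl)

endsAt-last : ∀ {n L p} → last L ≡ just p → EndsAt n L → EndsAt n [ p ]
endsAt-last last≡ (inj₁ end) = inj₁ (trans (sym last≡) end)
endsAt-last last≡ (inj₂ end) = inj₂ (trans (sym last≡) end)

endsAt-column : ∀ {n L} o → last L ≡ just (pt o n (n ∸ 1)) → EndsAt n L
endsAt-column false last≡ = inj₂ last≡
endsAt-column true  last≡ = inj₁ last≡

data Climb (o : Bool) (c : ℕ) : ℕ → List Pt → Set where
  stop : ∀ {b} → Climb o c b []
  turn : ∀ {b c' Z} → c < c' → Linked Move (pt o c' b ∷ Z) → Climb o c b (pt o c' b ∷ Z)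
  up   : ∀ {b d R} → b < d → Climb o c d R → Climb o c b (pt o c d ∷ R)

climb : ∀ o c b {R} → Linked Move (pt o c b ∷ R) → Climb o c b R
climb o c b [-]      = stop
climb o c b (m ∷ ms) with move-from o c b m
... | up b<d     = up b<d (climb o c _ ms)
... | right c<c' = turn c<c' ms

data Exit (n y : ℕ) (o : Bool) : List ℕ → List Pt → Set where
  via-n   : ∀ {zs} → Linked _<_ (y ∷ zs ∷ʳ suc n) → All (_< n) (y ∷ zs) →
            Exit n y o zs (map (pt o n) (y ∷ zs ∷ʳ suc n))
  via-1+n : ∀ {zs} → Linked _<_ (y ∷ zs ∷ʳ n) → All (_< n) (y ∷ zs) →
            Exit n y o zs (map (pt o (suc n)) (y ∷ zs ∷ʳ n))
  corner  : y < n → Exit n y o [] (pt o n y ∷ pt o (suc n) y ∷ pt o (suc n) n ∷ [])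

module _ {n : ℕ} {o : Bool} where

  private
    column≤ : ∀ {c d} → OffDiag (suc n) (pt o c d) → c ≤ suc n
    column≤ {c} {d} od = proj₂ (proj₁ (offDiag-pt⁻ (suc n) o c d od))

    height≢ : ∀ {c d} → OffDiag (suc n) (pt o c d) → d ≢ c
    height≢ {c} {d} od = ≢-sym (proj₂ (proj₂ (offDiag-pt⁻ (suc n) o c d od)))

  climb-column-1+n : ∀ {b R} → Climb o (suc n) b R → All (OffDiag (suc n)) R →
    EndsAt (suc n) (pt o (suc n) b ∷ R) →
    ∃[ hs ] (R ≡ map (pt o (suc n)) hs × Linked _<_ (b ∷ hs) × last (b ∷ hs) ≡ just n)
  climb-column-1+n stop _ end with endsAt-pt o (suc n) _ end
  ... | inj₁ (1+n≡n , _) = ⊥-elim (1+n≢n 1+n≡n)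
  ... | inj₂ (_ , b≡n)   = [] , refl , [-] , cong just b≡n
  climb-column-1+n (turn 1+n<c' _) (od ∷ _) _ = ⊥-elim (<⇒≱ 1+n<c' (column≤ od))
  climb-column-1+n (up b<d cl) (_ ∷ ods) end with climb-column-1+n cl ods end
  ... | hs , refl , lk , last≡ = _ ∷ hs , refl , b<d ∷ lk , last≡

  -- Coherence with the step (x → n; y) entering column n forbids every later step
  -- (z → z'; n + 1) with y < z < n.
  turn-at-entry : ∀ {x y b hs} → y ≤ b → b ≢ n → Linked _<_ (b ∷ hs) → last (b ∷ hs) ≡ just n →
    All (CoherentPair ⟨ x ⟶ n ∣ y ⟩) (chain (suc n) (b ∷ hs)) → b ≡ y × hs ≡ [ n ]
  turn-at-entry {x} {y} {b} {hs} y≤b b≢n lk last≡ coh with ∷ʳ-view hs last≡ b≢n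
  ... | zs , refl with chain-coherent⁻ ⟨ x ⟶ n ∣ y ⟩ (b ∷ zs) n (1+n≢n {n}) coh | linked-<-last (b ∷ zs) lk
  turn-at-entry _ _ _ _ _ | [] , refl | b≡y ∷ [] | b<n ∷ [] = b≡y b<n , refl
  turn-at-entry y≤b _ (b<d ∷ _) _ _ | _ ∷ _ , refl | _ ∷ d≡y ∷ _ | _ ∷ d<n ∷ _ =
    ⊥-elim (<⇒≱ b<d (≤-trans (≤-reflexive (d≡y d<n)) y≤b))

  climb-column-n : ∀ {x y b R} → y ≤ b → Climb o n b R → All (OffDiag (suc n)) (pt o n b ∷ R) →
    EndsAt (suc n) (pt o n b ∷ R) → All (CoherentPair ⟨ x ⟶ n ∣ y ⟩) (steps (pt o n b ∷ R)) →
    (∃[ hs ] (R ≡ map (pt o n) hs × Linked _<_ (b ∷ hs) × last (b ∷ hs) ≡ just (suc n)))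
    ⊎ (b ≡ y × R ≡ pt o (suc n) b ∷ pt o (suc n) n ∷ [])
  climb-column-n _ stop _ end _ with endsAt-pt o n _ end
  ... | inj₁ (_ , b≡1+n) = inj₁ ([] , refl , [-] , cong just b≡1+n)
  ... | inj₂ (n≡1+n , _) = ⊥-elim (1+n≢n (sym n≡1+n))
  climb-column-n {x} {b = b} y≤b (turn n<c' ms) (od ∷ od' ∷ ods) end (_ ∷ coh)
    with ≤-antisym (column≤ od') n<c'
  ... | refl with climb-column-1+n (climb o (suc n) b ms) ods end
  ...   | hs , refl , lk , last≡
    with turn-at-entry {x} y≤b (height≢ od) lk last≡ (subst (All _) (steps-column o (suc n) lk) coh)
  ...     | b≡y , refl = inj₂ (b≡y , refl)
  climb-column-n {x} y≤b (up b<d cl) (_ ∷ ods) end (_ ∷ coh)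
    with climb-column-n {x} (≤-trans y≤b (<⇒≤ b<d)) cl ods end coh
  ... | inj₁ (hs , refl , lk , last≡) = inj₁ (_ ∷ hs , refl , b<d ∷ lk , last≡)
  ... | inj₂ (d≡y , _) = ⊥-elim (<⇒≱ b<d (≤-trans (≤-reflexive d≡y) y≤b))

  exit-shape : ∀ {x y c T} → y < n → n ≤ c → Linked Move (pt o c y ∷ T) →
    All (OffDiag (suc n)) (pt o c y ∷ T) → EndsAt (suc n) (pt o c y ∷ T) →
    All (CoherentPair ⟨ x ⟶ c ∣ y ⟩) (steps (pt o c y ∷ T)) → ∃[ zs ] Exit n y o zs (pt o c y ∷ T)
  exit-shape {y = y} y<n n≤c ms ods@(od ∷ _) end coh with m≤n⇒m<n∨m≡n (column≤ od)
  ... | inj₂ refl with climb-column-1+n (climb o (suc n) y ms) (All.tail ods) end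
  ...   | hs , refl , lk , last≡ with ∷ʳ-view hs last≡ (<⇒≢ y<n)
  ...     | zs , refl = zs , via-1+n lk (linked-<-last (y ∷ zs) lk)
  exit-shape {x} {y} y<n n≤c ms ods end coh | inj₁ c<1+n with ≤-antisym (≤-pred c<1+n) n≤c
  ... | refl with climb-column-n {x} ≤-refl (climb o n y ms) ods end coh
  ...   | inj₂ (_ , refl) = [] , corner y<n
  ...   | inj₁ (hs , refl , lk , last≡) with ∷ʳ-view hs last≡ (<⇒≢ (m<n⇒m<1+n y<n))
  ...     | zs , refl = zs , via-n lk (below-top (linked-<-last (y ∷ zs) lk) (All-∷ʳ⁻ (y ∷ zs) (All.map⁻ ods)))
    where
    below-top : ∀ {hs} → All (_< suc n) hs →
      All (λ z → OffDiag (suc n) (pt o n z)) hs × OffDiag (suc n) (pt o n (suc n)) → All (_< n) hs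
    below-top <1+n (ods , _) = All.zipWith (λ (z<1+n , od) → ≤∧≢⇒< (≤-pred z<1+n) (height≢ od)) (<1+n , ods)

module _ {n y : ℕ} {o : Bool} (x : ℕ) where

  exit-steps : ∀ {zs W} → Exit n y o zs W → List EStep
  exit-steps {zs} (via-n _ _)   = ⟨ x ⟶ n ∣ y ⟩ ∷ chain n (y ∷ zs ∷ʳ suc n)
  exit-steps {zs} (via-1+n _ _) = ⟨ x ⟶ suc n ∣ y ⟩ ∷ chain (suc n) (y ∷ zs ∷ʳ n)
  exit-steps (corner _)         = ⟨ x ⟶ n ∣ y ⟩ ∷ ⟨ n ⟶ suc n ∣ y ⟩ ∷ ⟨ y ⟶ n ∣ suc n ⟩ ∷ []

  steps-exit : ∀ {zs W} → x < n → (e : Exit n y o zs W) → steps (pt o x y ∷ W) ≡ exit-steps e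
  steps-exit x<n (via-n lk _) =
    cong₂ _∷_ (step-horizontal o y (<⇒≢ x<n)) (steps-column o n lk)
  steps-exit x<n (via-1+n lk _) =
    cong₂ _∷_ (step-horizontal o y (<⇒≢ (m<n⇒m<1+n x<n))) (steps-column o (suc n) lk)
  steps-exit x<n (corner y<n)
    rewrite step-horizontal o y (<⇒≢ x<n) | step-horizontal o y (<⇒≢ (n<1+n n))
          | step-vertical o (suc n) (<⇒≢ y<n) = refl

  exit-restrict : ∀ {zs W} → Exit n y o zs W →
    dedup (fixLast n (pt o x y ∷ map (clampP n) W)) ≡ dedup (pt o x y ∷ map (pt o n) (y ∷ zs ∷ʳ (n ∸ 1)))
  exit-restrict {zs} (via-n _ <n) = cong dedup (begin
    fixLast n (pt o x y ∷ map (clampP n) (map (pt o n) (y ∷ zs ∷ʳ suc n)))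
      ≡⟨ cong (λ R → fixLast n (pt o x y ∷ R))
              (clampP-column n o (y ∷ zs) (clampC-n n) (clampC-suc n) (All.map m<n⇒m<1+n <n)) ⟩
    fixLast n (pt o x y ∷ map (pt o n) (y ∷ zs ∷ʳ n))
      ≡⟨ fixLast-column n o (pt o x y) zs (All.map <⇒≢ <n) ⟩
    pt o x y ∷ map (pt o n) (y ∷ zs ∷ʳ (n ∸ 1)) ∎)
    where open ≡-Reasoning
  exit-restrict {zs} (via-1+n _ <n) = cong dedup (begin
    fixLast n (pt o x y ∷ map (clampP n) (map (pt o (suc n)) (y ∷ zs ∷ʳ n)))
      ≡⟨ cong (λ R → fixLast n (pt o x y ∷ R))
              (clampP-column n o (y ∷ zs) (clampC-suc n) (clampC-n n) (All.map m<n⇒m<1+n <n)) ⟩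
    fixLast n (pt o x y ∷ map (pt o n) (y ∷ zs ∷ʳ n))
      ≡⟨ fixLast-column n o (pt o x y) zs (All.map <⇒≢ <n) ⟩
    pt o x y ∷ map (pt o n) (y ∷ zs ∷ʳ (n ∸ 1)) ∎)
    where open ≡-Reasoning
  exit-restrict (corner y<n) = begin
    dedup (fixLast n (pt o x y ∷ map (clampP n) (pt o n y ∷ pt o (suc n) y ∷ pt o (suc n) n ∷ [])))
      ≡⟨ cong (λ R → dedup (fixLast n (pt o x y ∷ R))) clamped ⟩
    dedup (pt o x y ∷ pt o n y ∷ pt o n y ∷ newLast n (pt o n y) (pt o n n) ∷ [])
      ≡⟨ cong (λ r → dedup (pt o x y ∷ pt o n y ∷ pt o n y ∷ r ∷ []))
              (newLast-column n o (pt o n n) (<⇒≢ y<n)) ⟩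
    dedup (pt o x y ∷ pt o n y ∷ pt o n y ∷ pt o n (n ∸ 1) ∷ [])
      ≡⟨ dedup-repeat [ pt o x y ] (pt o n y) [ pt o n (n ∸ 1) ] ⟩
    dedup (pt o x y ∷ pt o n y ∷ pt o n (n ∸ 1) ∷ []) ∎
    where
    open ≡-Reasoning
    y≡ : clampC n y ≡ y
    y≡ = clampC-< n (m<n⇒m<1+n y<n)
    clamped : map (clampP n) (pt o n y ∷ pt o (suc n) y ∷ pt o (suc n) n ∷ []) ≡
              pt o n y ∷ pt o n y ∷ pt o n n ∷ []
    clamped = cong₂ _∷_ (clampP-pt n o (clampC-n n) y≡)
             (cong₂ _∷_ (clampP-pt n o (clampC-suc n) y≡) (cong [_] (clampP-pt n o (clampC-suc n) (clampC-n n))))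

  exit-transfer : ∀ {zs W} (e : Exit n y o zs W) s → tgt s < n → All (CoherentPair s) (exit-steps e) →
    CoherentPair s ⟨ x ⟶ n ∣ y ⟩ × All (CoherentSource s) (y ∷ zs)
  exit-transfer {zs} (via-n _ _) s t<n (h ∷ hs) =
    h , chain-coherent⁻ s (y ∷ zs) (suc n) (>⇒≢ t<n) hs
  exit-transfer {zs} (via-1+n _ _) s t<n (h ∷ hs) =
    h , chain-coherent⁻ s (y ∷ zs) n (>⇒≢ (m<n⇒m<1+n t<n)) hs
  exit-transfer (corner _) s t<n (h ∷ _ ∷ h' ∷ []) =
    h , coherentPair⇒source s ⟨ y ⟶ n ∣ suc n ⟩ (>⇒≢ (m<n⇒m<1+n t<n)) h' ∷ []

exit-heights : ∀ {n y o zs W} → Exit n y o zs W → Linked _<_ (y ∷ zs) × All (_< n) (y ∷ zs)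
exit-heights {y = y} {zs = zs} (via-n lk <n)   = linked-++⁻ˡ (y ∷ zs) lk , <n
exit-heights {y = y} {zs = zs} (via-1+n lk <n) = linked-++⁻ˡ (y ∷ zs) lk , <n
exit-heights (corner y<n)                      = [-] , y<n ∷ []

inner? : ∀ n p → Dec (Inner n p)
inner? n (a , b) = (a <? n) ×-dec (b <? n)

first-exit : ∀ {n} p L → Inner n p → (∀ {z} → last (p ∷ L) ≡ just z → ¬ Inner n z) →
  ∃[ P ] ∃[ q ] ∃[ t ] ∃[ T ] (p ∷ L ≡ P ++ q ∷ t ∷ T × All (Inner n) (P ∷ʳ q) × ¬ Inner n t)
first-exit p []      p-inner outer = ⊥-elim (outer refl p-inner)
first-exit {n} p (r ∷ L) p-inner outer with inner? n r
... | no r-outer = [] , p , r , L , refl , p-inner ∷ [] , r-outer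
... | yes r-inner with first-exit r L r-inner outer
...   | P , q , t , T , L≡ , inners , t-outer =
  p ∷ P , q , t , T , cong (p ∷_) L≡ , p-inner ∷ inners , t-outer

exit-decomposition : ∀ n → 3 ≤ n → ∀ L → Coherent (suc n) L →
  ∃[ P ] ∃[ o ] ∃[ x ] ∃[ y ] ∃[ c ] ∃[ T ]
    (L ≡ P ++ pt o x y ∷ pt o c y ∷ T × All (Inner n) (P ∷ʳ pt o x y) × n ≤ c)
exit-decomposition n 3≤n [] ((() , _) , _)
exit-decomposition n 3≤n (p ∷ L) ((refl , ends , _ , moves) , _)
  with first-exit p L (3≤n , ≤-trans (s≤s (s≤s z≤n)) 3≤n) end-outer
  where
  end-outer : ∀ {z} → last (p ∷ L) ≡ just z → ¬ Inner n z
  end-outer last≡ with endsAt-last {L = p ∷ L} last≡ ends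
  ... | inj₁ refl = λ (n<n , _) → <-irrefl refl n<n
  ... | inj₂ refl = λ (_ , n<n) → <-irrefl refl n<n
... | P , q , t , T , L≡ , inners , t-outer
  with move-oriented (Linked.head (linked-++⁻ʳ P (subst (Linked Move) L≡ moves)))
... | o , x , y , c , refl , refl , _ =
  P , o , x , y , c , T , L≡ , inners , ≮⇒≥ (λ c<n → t-outer (inner-pt⁺ o (c<n , y<n)))
  where
  y<n : y < n
  y<n = proj₂ (inner-pt⁻ n o x y (proj₂ (All-∷ʳ⁻ P inners)))

module Restriction {n : ℕ} {P : List Pt} {o : Bool} {x y : ℕ} {t : Pt} {T : List Pt}
  (coh : Coherent (suc n) (P ++ pt o x y ∷ t ∷ T)) (inner : All (Inner n) (P ∷ʳ pt o x y)) where

  q : Pt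
  q = pt o x y

  SP : List EStep
  SP = steps (P ∷ʳ q)

  private
    dalp : DALP (suc n) (P ++ q ∷ t ∷ T)
    dalp = proj₁ coh

    offDiags : All (OffDiag (suc n)) P × All (OffDiag (suc n)) (q ∷ t ∷ T)
    offDiags = All.++⁻ P (proj₁ (proj₂ (proj₂ dalp)))

    moves : Linked Move (P ++ q ∷ t ∷ T)
    moves = proj₂ (proj₂ (proj₂ dalp))

    split-coherence : AllPairs CoherentPair SP × AllPairs CoherentPair (steps (q ∷ t ∷ T)) ×
                      All (λ s → All (CoherentPair s) (steps (q ∷ t ∷ T))) SP
    split-coherence = allPairs-++⁻ SP (subst (AllPairs CoherentPair) (steps-++ P q (t ∷ T)) (proj₂ coh))

  x<n : x < n
  x<n = proj₁ (inner-pt⁻ n o x y (proj₂ (All-∷ʳ⁻ P inner)))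

  y<n : y < n
  y<n = proj₂ (inner-pt⁻ n o x y (proj₂ (All-∷ʳ⁻ P inner)))

  0<n : 0 < n
  0<n = ≤-<-trans z≤n x<n

  q-offDiag : OffDiag (suc n) (x , y)
  q-offDiag = offDiag-pt⁻ (suc n) o x y (All.head (proj₂ offDiags))

  1≤y : 1 ≤ y
  1≤y = proj₁ (proj₁ (proj₂ q-offDiag))

  prefix-head : head (P ∷ʳ q) ≡ just (2 , 1)
  prefix-head = trans (sym (head-++ P q (t ∷ T))) (proj₁ dalp)

  prefix-offDiag : All (OffDiag n) (P ∷ʳ q)
  prefix-offDiag = All.zipWith shrink (inner , All.++⁺ (proj₁ offDiags) (All.head (proj₂ offDiags) ∷ []))
    where
    shrink : ∀ {p} → Inner n p × OffDiag (suc n) p → OffDiag n p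
    shrink ((a<n , b<n) , (1≤a , _) , (1≤b , _) , a≢b) = (1≤a , <⇒≤ a<n) , (1≤b , <⇒≤ b<n) , a≢b

  prefix-moves : Linked Move (P ∷ʳ q)
  prefix-moves = linked-++⁻ˡ (P ∷ʳ q) (subst (Linked Move) (sym (++-assoc P [ q ] (t ∷ T))) moves)

  steps-restricted : ∀ {rs} → Linked _<_ (y ∷ rs) →
    steps (P ++ q ∷ map (pt o n) (y ∷ rs)) ≡ SP ++ ⟨ x ⟶ n ∣ y ⟩ ∷ chain n (y ∷ rs)
  steps-restricted {rs} lk = trans (steps-++ P q (map (pt o n) (y ∷ rs)))
    (cong (SP ++_) (cong₂ _∷_ (step-horizontal o y (<⇒≢ x<n)) (steps-column o n lk)))

  restricted-moves : ∀ {rs} → Linked _<_ (y ∷ rs) → Linked Move (q ∷ map (pt o n) (y ∷ rs))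
  restricted-moves lk = move-horizontal o y x<n ∷ moves-column o n lk

  restriction-coherent : ∀ {rs} → Linked _<_ (y ∷ rs) → last (y ∷ rs) ≡ just (n ∸ 1) →
    All (λ s → CoherentPair s ⟨ x ⟶ n ∣ y ⟩ × All (CoherentSource s) (y ∷ rs)) SP →
    Coherent n (P ++ q ∷ map (pt o n) (y ∷ rs))
  restriction-coherent {rs} lk last≡ cross = (head≡ , ends , offDiag , moves′) , pairs
    where
    head≡ : head (P ++ q ∷ map (pt o n) (y ∷ rs)) ≡ just (2 , 1)
    head≡ = trans (head-++ P q _) prefix-head
    ends : EndsAt n (P ++ q ∷ map (pt o n) (y ∷ rs))
    ends = endsAt-column {L = P ++ q ∷ map (pt o n) (y ∷ rs)} o
      (trans (last-++ P q (map (pt o n) (y ∷ rs)))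
             (trans (last-map (pt o n) (y ∷ rs)) (cong (Maybe.map (pt o n)) last≡)))
    column-offDiag : ∀ {z} → y ≤ z × z ≤ n ∸ 1 → OffDiag n (pt o n z)
    column-offDiag {z} (y≤z , z≤) = offDiag-pt⁺ n o n z
      ( (0<n , ≤-refl)
      , (≤-trans 1≤y y≤z , ≤-trans z≤ (m∸n≤m n 1))
      , >⇒≢ (≤-<-trans z≤ (∸1< 0<n)))
    offDiag : All (OffDiag n) (P ++ q ∷ map (pt o n) (y ∷ rs))
    offDiag with All-∷ʳ⁻ P prefix-offDiag
    ... | offDiag-P , offDiag-q = All.++⁺ offDiag-P (offDiag-q ∷ All.map⁺
      (All.zipWith column-offDiag (linked-<-head rs lk , linked-≤-last (y ∷ rs) lk last≡)))
    moves′ : Linked Move (P ++ q ∷ map (pt o n) (y ∷ rs))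
    moves′ = linked-join P q prefix-moves (restricted-moves lk)
    pairs : AllPairs CoherentPair (steps (P ++ q ∷ map (pt o n) (y ∷ rs)))
    pairs = subst (AllPairs CoherentPair) (sym (steps-restricted lk))
      (AllPairs.++⁺ (proj₁ split-coherence) (chain-in-target-coherent x n y (y ∷ rs) ∷ chain-coherent n lk)
        (All.map (λ {s} (h , sources) → h ∷ chain-coherent⁺ s n sources) cross))

  exit-sources : ∀ {zs} (e : Exit n y o zs (t ∷ T)) →
    All (λ s → CoherentPair s ⟨ x ⟶ n ∣ y ⟩ × All (CoherentSource s) (y ∷ zs)) SP
  exit-sources e = All.zipWith
    (λ {s} (t<n , h) → exit-transfer x e s t<n (subst (All (CoherentPair s)) (steps-exit x x<n e) h))
    (steps-inner n inner , proj₂ (proj₂ split-coherence))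

  x<n∸1-top : y ≡ n ∸ 1 → x < n ∸ 1
  x<n∸1-top y≡ = ≤∧≢⇒< (<⇒≤∸1 x<n) (λ x≡ → proj₂ (proj₂ q-offDiag) (trans x≡ (sym y≡)))

  -- If x = n - 1, the prefix crosses column w by a step below height y, and that step is
  -- incoherent with any later step leaving height w.
  x<n∸1-crossed : ∀ {w} → y < w → w < n ∸ 1 → All (λ s → CoherentSource s w) SP → x < n ∸ 1
  x<n∸1-crossed {w} y<w w< sources with m≤n⇒m<n∨m≡n (<⇒≤∸1 x<n)
  ... | inj₁ x< = x<
  ... | inj₂ x≡ with crossing-from-start o w prefix-head prefix-moves
                       (trans (last-∷ʳ P q) (cong (λ a → just (pt o a y)) x≡)) (≤-trans (s≤s 1≤y) y<w) w<
  ...   | s , s∈ , _ , w<tgt , _ , oth≤y =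
    ⊥-elim (<⇒≱ y<w (subst (_≤ y) (sym (All.lookup sources s∈ w<tgt)) oth≤y))

  x<n∸1-many : ∀ {zs mid w} → Exit n y o zs (t ∷ T) → w ∈ zs →
    Linked _<_ (y ∷ mid ++ w ∷ n ∸ 1 ∷ []) → x < n ∸ 1
  x<n∸1-many {mid = mid} e w∈ lk =
    x<n∸1-crossed (All.lookup (linked-<-tail _ lk) (∈-++⁺ʳ mid (here refl))) (linked-∷ʳ₂ (y ∷ mid) lk)
      (All.map (λ (_ , sources) → All.lookup sources (there w∈)) (exit-sources e))

  Conclusion : Set
  Conclusion = Coherent n (restrict n (P ++ q ∷ t ∷ T)) × ExactlyOneCase n (P ++ q ∷ t ∷ T)

  conclude : ∀ {zs rs} (e : Exit n y o zs (t ∷ T)) → Column n y zs rs → ∀ c →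
    Case n (SP ++ exit-steps x e) (SP ++ ⟨ x ⟶ n ∣ y ⟩ ∷ chain n (y ∷ rs)) c → Conclusion
  conclude {zs} {rs} e v c case =
    subst (Coherent n) (sym restrict≡) (restriction-coherent lk (column-last v) sources) ,
    c , case′ , λ d → case-unique 0<n c d case′
    where
    lk : Linked _<_ (y ∷ rs)
    lk = column-linked v
    restrict≡ : restrict n (P ++ q ∷ t ∷ T) ≡ P ++ q ∷ map (pt o n) (y ∷ rs)
    restrict≡ = restrict-++ n P q t T inner (Linked.map move⇒≢ prefix-moves)
      (trans (exit-restrict x e) (column-dedup o q v (Linked.map move⇒≢ (restricted-moves lk))))
    sources : All (λ s → CoherentPair s ⟨ x ⟶ n ∣ y ⟩ × All (CoherentSource s) (y ∷ rs)) SP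
    sources = All.zipWith
      (λ (t<n , h , sources) → h , column-All v sources (λ n∸1<t → ⊥-elim (<⇒≱ n∸1<t (<⇒≤∸1 t<n))))
      (steps-inner n inner , exit-sources e)
    case′ : Case n (steps (P ++ q ∷ t ∷ T)) (steps (restrict n (P ++ q ∷ t ∷ T))) c
    case′ = subst₂ (λ S S′ → Case n S S′ c)
      (sym (trans (steps-++ P q (t ∷ T)) (cong (SP ++_) (steps-exit x x<n e))))
      (sym (trans (cong steps restrict≡) (steps-restricted lk)))
      case

  conclusion : ∀ {zs rs} (e : Exit n y o zs (t ∷ T)) → Column n y zs rs → Conclusion
  conclusion e@(via-n _ _) v@(top y≡) =
    conclude e v i-a (i-a-case n SP x y≡ (x<n∸1-top y≡))
  conclusion e@(via-n _ _) v@(two-added y<) =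
    conclude e v iii-b (iii-b-case n SP x x<n y<)
  conclusion e@(via-n _ _) v@(two-reached y<) =
    conclude e v iii-a (iii-a-case n SP x x<n y<)
  conclusion e@(via-n _ _) v@(many-reached mid w lk) =
    conclude e v ii-a (ii-a-case n SP x mid w (x<n∸1-many e (∈-++⁺ʳ mid (here refl)) lk) lk)
  conclusion e@(via-n _ _) v@(many-added mid w lk) =
    conclude e v ii-b (ii-b-case n SP x mid w (x<n∸1-many e (∈-++⁺ʳ mid (here refl)) lk) lk)
  conclusion e@(via-1+n _ _) v@(top y≡) =
    conclude e v i-c (i-c-case n SP x y≡ (x<n∸1-top y≡))
  conclusion e@(via-1+n _ _) v@(two-added y<) =
    conclude e v iii-e (iii-e-case n SP x x<n y<)
  conclusion e@(via-1+n _ _) v@(two-reached y<) =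
    conclude e v iii-d (iii-d-case n SP x x<n y<)
  conclusion e@(via-1+n _ _) v@(many-reached mid w lk) =
    conclude e v ii-c (ii-c-case n SP x mid w (x<n∸1-many e (∈-++⁺ʳ mid (here refl)) lk) lk)
  conclusion e@(via-1+n _ _) v@(many-added mid w lk) =
    conclude e v ii-d (ii-d-case n SP x mid w (x<n∸1-many e (∈-++⁺ʳ mid (here refl)) lk) lk)
  conclusion e@(corner y<n) _ with m≤n⇒m<n∨m≡n (<⇒≤∸1 y<n)
  ... | inj₂ y≡ = conclude e (top y≡) i-b (i-b-case n SP x y≡ (x<n∸1-top y≡))
  ... | inj₁ y< = conclude e (two-added y<) iii-c (iii-c-case n SP x x<n y<)

  exit : ∀ {c} → t ≡ pt o c y → n ≤ c → ∃[ zs ] Exit n y o zs (t ∷ T)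
  exit refl n≤c = exit-shape {x = x} y<n n≤c (Linked.tail tail-moves) (All.tail (proj₂ offDiags)) ends
    (subst (λ s → All (CoherentPair s) _) (step-horizontal o y (<⇒≢ (<-≤-trans x<n n≤c))) first-pairs)
    where
    tail-moves : Linked Move (q ∷ t ∷ T)
    tail-moves = linked-++⁻ʳ P moves
    first-pairs : All (CoherentPair (step q t)) (steps (t ∷ T))
    first-pairs = allPairs-head (proj₁ (proj₂ split-coherence))
    ends : EndsAt (suc n) (t ∷ T)
    ends = Sum.map (trans (sym (last-++ P q (t ∷ T)))) (trans (sym (last-++ P q (t ∷ T)))) (proj₁ (proj₂ dalp))

theorem4p7 : (n : ℕ) → 3 ≤ n → (L : List Pt) → Coherent (suc n) L →
    Coherent n (restrict n L) × ExactlyOneCase n L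
theorem4p7 n 3≤n L coh with exit-decomposition n 3≤n L coh
... | P , o , x , y , c , T , refl , inner , n≤c with Restriction.exit coh inner refl n≤c
...   | zs , e with exit-heights e
...     | increasing , below = Restriction.conclusion coh inner e (proj₂ (column zs increasing below))
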